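{- For all integers $\alpha\ge 0$ and $n\ge 0$, \[ a_{2,4}\!\left(3^{2\alpha+3}n+3^{2(\alpha+1)}\right)\equiv 0 \pmod 3 \quad\text{and}\quad a_{2,4}\!\left(3^{2\alpha+3}n+2\cdot 3^{2(\alpha+1)}\right)\equiv 0 \pmod 3. \]
   Context: For positive integers $r,s$, $a_{r,s}(n)$ denotes the number of multicolored partitions of $n$ in which each even part may appear in one of $r$ colors and each odd part may appear in one of $s$ colors (copies of the same part size in different colors are distinct), with $a_{r,s}(0)=1$. Equivalently, for $|q|<1$, $\sum_{n\ge0}a_{r,s}(n)q^n = f_2^{s-r}/f_1^{s}$, where $f_m=\prod_{i\ge1}(1-q^{mi})$. In particular $\sum_{n\ge0}a_{2,4}(n)q^n=f_2^2/f_1^4$. -}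

module Defs where

open import Data.Nat using (ℕ; zero; suc; _+_; _*_; _∸_)
open import Data.Nat.Properties using (_≤?_)
open import Data.Bool using (Bool; true; false; if_then_else_)
open import Data.List using (List; []; _∷_; _++_; replicate; upTo; sum; map; applyUpTo)
open import Relation.Nullary using (yes; no)

isEven : ℕ → Bool
isEven zero = true
isEven (suc zero) = false
isEven (suc (suc n)) = isEven n

colours : ℕ → ℕ → ℕ → ℕ
colours r s k = if isEven k then r else s

-- The list of "coloured part types" of size at most N: each size k ∈ {1..N}
-- appears once for each of its colours (list entry = the part size).
partTypes : ℕ → ℕ → ℕ → List ℕ
partTypes r s zero = []
partTypes r s (suc N) = partTypes r s N ++ replicate (colours r s (suc N)) (suc N)

-- ways ts n : number of ways to choose a multiplicity m_t ≥ 0 for every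
-- coloured part type t in ts so that Σ m_t * size(t) = n,
-- i.e. the number of (multi)coloured partitions of n using part types from ts.
ways : List ℕ → ℕ → ℕ
ways [] zero = 1
ways [] (suc _) = 0
ways (k ∷ ks) n = go n n
  where
  -- go fuel rem : sum over multiplicities j of part k, with rem = n ∸ j*k
  go : ℕ → ℕ → ℕ
  go zero rem = ways ks rem
  go (suc f) rem with k ≤? rem
  ... | yes _ = ways ks rem + go f (rem ∸ k)
  ... | no _  = ways ks rem

-- a_{r,s}(n): number of multicoloured partitions of n in which each even part
-- may appear in one of r colours and each odd part in one of s colours.
-- Only parts of size ≤ n can occur, so part types up to size n suffice.
a : ℕ → ℕ → ℕ → ℕ
a r s n = ways (partTypes r s n) n

{-# OPTIONS --safe #-}
-- Everything is reduced modulo 3: power series have coefficients in 𝔽₃ and are compared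
-- modulo q^K where needed. Write A = f₂²/f₁⁴ for the generating function of a₂,₄ and
-- φ = φ(-q) = Σ_k (-1)^k q^(k²). Gauss's identity φ = f₁²/f₂ gives A φ² = 1, and the
-- Frobenius gives φ³ = φ(-q³), hence A φ(-q³) = φ. Atkin's operator U₃ satisfies
-- U₃(F(q³) G) = F · U₃ G, so φ · U₃ A = U₃ (φ(-q³) A) = U₃ φ = φ(-q³) = φ³, that is,
-- Σ a₂,₄(3n) qⁿ ≡ φ² (mod 3). The coefficient of qⁿ in φ² vanishes unless n is a sum of
-- two squares, and the theorem is about a₂,₄(3n) for n = 3^(2α+1)(3m+1) and 3^(2α+1)(3m+2),
-- which are not.
-- Gauss's identity is the case a = b = N of a finite triple product identity, which
-- follows from the q-Pascal recurrence of the Gaussian binomials.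
module Submission where

open import Defs
open import Level using (0ℓ)
open import Data.Nat using (ℕ; zero; suc; _+_; _*_; _∸_; _^_; _%_; _<_; _≤_; z≤n; s≤s; _⊓_; ∣_-_∣; >-nonZero)
import Data.Nat.Properties as ℕ
open import Data.Nat.Properties using (_≤?_)
open import Data.Nat.Tactic.RingSolver using (solve-∀)
open import Data.Product using (_×_; _,_; proj₁; proj₂; ∃-syntax)
open import Data.List using (List; []; _∷_; _++_; replicate; foldr)
open import Data.List.Relation.Unary.All using (All; []; _∷_)
open import Data.List.Relation.Unary.All.Properties using (++⁺; replicate⁺)
open import Data.Maybe using (Maybe; just; nothing)
open import Data.Bool using (true; false)
open import Data.Empty using (⊥-elim)
open import Data.Nat.Divisibility
  using (_∣_; divides; _∣0; n∣n; m∣m*n; ∣m⇒∣m*n; ∣m∣n⇒∣m+n; ∣m+n∣m⇒∣n; >⇒∤; n∣m⇒m%n≡0)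
open import Function using (_∘_)
open import Algebra.Bundles using (CommutativeRing)
open import Algebra.Structures using (IsCommutativeRing)
import Algebra.Solver.Ring.AlmostCommutativeRing as ACR
import Algebra.Solver.Ring
import Algebra.Properties.CommutativeSemigroup
open import Relation.Nullary using (Dec; yes; no; ¬_)
open import Relation.Nullary.Decidable using (from-yes; map′; _×-dec_; _→-dec_)
open import Relation.Unary using (Decidable)
open import Relation.Binary.Bundles using (Setoid)
import Relation.Binary.Reasoning.Setoid
open import Relation.Binary.PropositionalEquality
  using (_≡_; _≢_; refl; sym; trans; cong; cong₂; subst; isEquivalence; module ≡-Reasoning)

-- The field 𝔽₃

data 𝔽₃ : Set where
  𝟎 𝟏 𝟐 : 𝔽₃

infixl 6 _+₃_
infixl 7 _*₃_
infix 8 -₃_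
infix 4 _≟₃_

-₃_ : 𝔽₃ → 𝔽₃
-₃ 𝟎 = 𝟎
-₃ 𝟏 = 𝟐
-₃ 𝟐 = 𝟏

_+₃_ : 𝔽₃ → 𝔽₃ → 𝔽₃
𝟎 +₃ b = b
𝟏 +₃ 𝟎 = 𝟏
𝟏 +₃ 𝟏 = 𝟐
𝟏 +₃ 𝟐 = 𝟎
𝟐 +₃ 𝟎 = 𝟐
𝟐 +₃ 𝟏 = 𝟎
𝟐 +₃ 𝟐 = 𝟏

_*₃_ : 𝔽₃ → 𝔽₃ → 𝔽₃
𝟎 *₃ b = 𝟎
𝟏 *₃ b = b
𝟐 *₃ b = -₃ b

_≟₃_ : (a b : 𝔽₃) → Dec (a ≡ b)
𝟎 ≟₃ 𝟎 = yes refl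
𝟏 ≟₃ 𝟏 = yes refl
𝟐 ≟₃ 𝟐 = yes refl
𝟎 ≟₃ 𝟏 = no λ ()
𝟎 ≟₃ 𝟐 = no λ ()
𝟏 ≟₃ 𝟎 = no λ ()
𝟏 ≟₃ 𝟐 = no λ ()
𝟐 ≟₃ 𝟎 = no λ ()
𝟐 ≟₃ 𝟏 = no λ ()

∀₃? : {P : 𝔽₃ → Set} → Decidable P → Dec (∀ a → P a)
∀₃? P? = map′ every (λ p → p 𝟎 , p 𝟏 , p 𝟐) (P? 𝟎 ×-dec P? 𝟏 ×-dec P? 𝟐)
  where
  every : _ → ∀ a → _
  every (p₀ , p₁ , p₂) 𝟎 = p₀
  every (p₀ , p₁ , p₂) 𝟏 = p₁
  every (p₀ , p₁ , p₂) 𝟐 = p₂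

𝔽₃-isCommutativeRing : IsCommutativeRing _≡_ _+₃_ _*₃_ -₃_ 𝟎 𝟏
𝔽₃-isCommutativeRing = record
  { isRing = record
    { +-isAbelianGroup = record
      { isGroup = record
        { isMonoid = record
          { isSemigroup = record
            { isMagma = record { isEquivalence = isEquivalence ; ∙-cong = cong₂ _+₃_ }
            ; assoc = from-yes (∀₃? λ a → ∀₃? λ b → ∀₃? λ c → (a +₃ b) +₃ c ≟₃ a +₃ (b +₃ c)) }
          ; identity = from-yes (∀₃? λ a → 𝟎 +₃ a ≟₃ a) , from-yes (∀₃? λ a → a +₃ 𝟎 ≟₃ a) }
        ; inverse = from-yes (∀₃? λ a → -₃ a +₃ a ≟₃ 𝟎) , from-yes (∀₃? λ a → a +₃ -₃ a ≟₃ 𝟎)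
        ; ⁻¹-cong = cong -₃_ }
      ; comm = from-yes (∀₃? λ a → ∀₃? λ b → a +₃ b ≟₃ b +₃ a) }
    ; *-cong = cong₂ _*₃_
    ; *-assoc = from-yes (∀₃? λ a → ∀₃? λ b → ∀₃? λ c → (a *₃ b) *₃ c ≟₃ a *₃ (b *₃ c))
    ; *-identity = from-yes (∀₃? λ a → 𝟏 *₃ a ≟₃ a) , from-yes (∀₃? λ a → a *₃ 𝟏 ≟₃ a)
    ; distrib = from-yes (∀₃? λ a → ∀₃? λ b → ∀₃? λ c → a *₃ (b +₃ c) ≟₃ a *₃ b +₃ a *₃ c)
              , from-yes (∀₃? λ a → ∀₃? λ b → ∀₃? λ c → (b +₃ c) *₃ a ≟₃ b *₃ a +₃ c *₃ a) }
  ; *-comm = from-yes (∀₃? λ a → ∀₃? λ b → a *₃ b ≟₃ b *₃ a) }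

𝔽₃-commutativeRing : CommutativeRing 0ℓ 0ℓ
𝔽₃-commutativeRing = record { isCommutativeRing = 𝔽₃-isCommutativeRing }

open CommutativeRing 𝔽₃-commutativeRing
  using ( +-comm; +-identityˡ; +-identityʳ; +-assoc; -‿inverseˡ; -‿inverseʳ
        ; *-comm; *-assoc; *-identityˡ; *-identityʳ; distribˡ; distribʳ)
  renaming (zeroˡ to *-zeroˡ; zeroʳ to *-zeroʳ; rawRing to 𝔽₃-rawRing)
open Algebra.Properties.CommutativeSemigroup (CommutativeRing.+-commutativeSemigroup 𝔽₃-commutativeRing)
  using (interchange)

cube₃ : ∀ a → a *₃ a *₃ a ≡ a
cube₃ = from-yes (∀₃? λ a → a *₃ a *₃ a ≟₃ a)

[_]₃ : ℕ → 𝔽₃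
[ zero ]₃ = 𝟎
[ suc n ]₃ = 𝟏 +₃ [ n ]₃

[]₃-+ : ∀ m n → [ m + n ]₃ ≡ [ m ]₃ +₃ [ n ]₃
[]₃-+ zero n = refl
[]₃-+ (suc m) n = trans (cong (𝟏 +₃_) ([]₃-+ m n)) (sym (+-assoc 𝟏 [ m ]₃ [ n ]₃))

[]₃-* : ∀ m n → [ m * n ]₃ ≡ [ m ]₃ *₃ [ n ]₃
[]₃-* zero n = refl
[]₃-* (suc m) n = begin
  [ n + m * n ]₃                   ≡⟨ trans ([]₃-+ n (m * n)) (cong ([ n ]₃ +₃_) ([]₃-* m n)) ⟩
  [ n ]₃ +₃ [ m ]₃ *₃ [ n ]₃        ≡⟨ sym (distribʳ [ n ]₃ 𝟏 [ m ]₃) ⟩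
  (𝟏 +₃ [ m ]₃) *₃ [ n ]₃          ∎
  where open ≡-Reasoning

[3*m]₃≡𝟎 : ∀ m → [ 3 * m ]₃ ≡ 𝟎
[3*m]₃≡𝟎 = []₃-* 3

-- Power series over 𝔽₃

Series : Set
Series = ℕ → 𝔽₃

infix 4 _≈_
_≈_ : Series → Series → Set
s ≈ t = ∀ n → s n ≡ t n

≈-refl : ∀ {s} → s ≈ s
≈-refl n = refl

≈-sym : ∀ {s t} → s ≈ t → t ≈ s
≈-sym e n = sym (e n)

≈-trans : ∀ {s t u} → s ≈ t → t ≈ u → s ≈ u
≈-trans e f n = trans (e n) (f n)

monomial : 𝔽₃ → ℕ → Series
monomial c zero zero = c
monomial c zero (suc n) = 𝟎
monomial c (suc e) zero = 𝟎
monomial c (suc e) (suc n) = monomial c e n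

constant : 𝔽₃ → Series
constant c = monomial c 0

q^ : ℕ → Series
q^ = monomial 𝟏

0ₛ 1ₛ : Series
0ₛ n = 𝟎
1ₛ = constant 𝟏

infixl 6 _+ₛ_
infixl 7 _*ₛ_
infix 8 -ₛ_

_+ₛ_ : Series → Series → Series
(s +ₛ t) n = s n +₃ t n

-ₛ_ : Series → Series
(-ₛ s) n = -₃ s n

shift : Series → Series
shift s n = s (suc n)

_*ₛ_ : Series → Series → Series
(s *ₛ t) zero = s 0 *₃ t 0
(s *ₛ t) (suc n) = s 0 *₃ t (suc n) +₃ (shift s *ₛ t) n

+ₛ-cong : ∀ {s s′ t t′} → s ≈ s′ → t ≈ t′ → s +ₛ t ≈ s′ +ₛ t′
+ₛ-cong e f n = cong₂ _+₃_ (e n) (f n)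

*ₛ-cong : ∀ {s s′ t t′} → s ≈ s′ → t ≈ t′ → s *ₛ t ≈ s′ *ₛ t′
*ₛ-cong e f zero = cong₂ _*₃_ (e 0) (f 0)
*ₛ-cong e f (suc n) = cong₂ _+₃_ (cong₂ _*₃_ (e 0) (f (suc n))) (*ₛ-cong (λ k → e (suc k)) f n)

*ₛ-zeroˡ : ∀ t → 0ₛ *ₛ t ≈ 0ₛ
*ₛ-zeroˡ t zero = refl
*ₛ-zeroˡ t (suc n) = *ₛ-zeroˡ t n

*ₛ-identityˡ : ∀ t → 1ₛ *ₛ t ≈ t
*ₛ-identityˡ t zero = refl
*ₛ-identityˡ t (suc n) = trans (cong (t (suc n) +₃_) (*ₛ-zeroˡ t n)) (+-identityʳ (t (suc n)))

*ₛ-distribʳ : ∀ u s t → (s +ₛ t) *ₛ u ≈ s *ₛ u +ₛ t *ₛ u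
*ₛ-distribʳ u s t zero = distribʳ (u 0) (s 0) (t 0)
*ₛ-distribʳ u s t (suc n) =
  trans (cong₂ _+₃_ (distribʳ (u (suc n)) (s 0) (t 0)) (*ₛ-distribʳ u (shift s) (shift t) n))
        (interchange (s 0 *₃ u (suc n)) (t 0 *₃ u (suc n)) ((shift s *ₛ u) n) ((shift t *ₛ u) n))

*ₛ-distribˡ : ∀ u s t → u *ₛ (s +ₛ t) ≈ u *ₛ s +ₛ u *ₛ t
*ₛ-distribˡ u s t zero = distribˡ (u 0) (s 0) (t 0)
*ₛ-distribˡ u s t (suc n) =
  trans (cong₂ _+₃_ (distribˡ (u 0) (s (suc n)) (t (suc n))) (*ₛ-distribˡ (shift u) s t n))
        (interchange (u 0 *₃ s (suc n)) (u 0 *₃ t (suc n)) ((shift u *ₛ s) n) ((shift u *ₛ t) n))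

scale-*ₛ : ∀ c s t n → ((λ k → c *₃ s k) *ₛ t) n ≡ c *₃ (s *ₛ t) n
scale-*ₛ c s t zero = *-assoc c (s 0) (t 0)
scale-*ₛ c s t (suc n) =
  trans (cong₂ _+₃_ (*-assoc c (s 0) (t (suc n))) (scale-*ₛ c (shift s) t n))
        (sym (distribˡ c (s 0 *₃ t (suc n)) ((shift s *ₛ t) n)))

*ₛ-unfoldʳ : ∀ s t n → (s *ₛ t) (suc n) ≡ (s *ₛ shift t) n +₃ s (suc n) *₃ t 0
*ₛ-unfoldʳ s t zero = refl
*ₛ-unfoldʳ s t (suc n) =
  trans (cong (s 0 *₃ t (suc (suc n)) +₃_) (*ₛ-unfoldʳ (shift s) t n))
        (sym (+-assoc (s 0 *₃ t (suc (suc n))) ((shift s *ₛ shift t) n) (s (suc (suc n)) *₃ t 0)))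

*ₛ-comm : ∀ s t → s *ₛ t ≈ t *ₛ s
*ₛ-comm s t zero = *-comm (s 0) (t 0)
*ₛ-comm s t (suc n) = begin
  s 0 *₃ t (suc n) +₃ (shift s *ₛ t) n  ≡⟨ cong₂ _+₃_ (*-comm (s 0) (t (suc n))) (*ₛ-comm (shift s) t n) ⟩
  t (suc n) *₃ s 0 +₃ (t *ₛ shift s) n  ≡⟨ +-comm (t (suc n) *₃ s 0) ((t *ₛ shift s) n) ⟩
  (t *ₛ shift s) n +₃ t (suc n) *₃ s 0  ≡⟨ sym (*ₛ-unfoldʳ t s n) ⟩
  (t *ₛ s) (suc n)                      ∎
  where open ≡-Reasoning

*ₛ-assoc : ∀ s t u → (s *ₛ t) *ₛ u ≈ s *ₛ (t *ₛ u)
*ₛ-assoc s t u zero = *-assoc (s 0) (t 0) (u 0)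
*ₛ-assoc s t u (suc n) = begin
  (s 0 *₃ t 0) *₃ u (suc n) +₃ ((s₀t′ +ₛ s′ *ₛ t) *ₛ u) n
    ≡⟨ cong ((s 0 *₃ t 0) *₃ u (suc n) +₃_) (*ₛ-distribʳ u s₀t′ (s′ *ₛ t) n) ⟩
  (s 0 *₃ t 0) *₃ u (suc n) +₃ ((s₀t′ *ₛ u) n +₃ ((s′ *ₛ t) *ₛ u) n)
    ≡⟨ cong₂ (λ x y → x +₃ (y +₃ ((s′ *ₛ t) *ₛ u) n))
             (*-assoc (s 0) (t 0) (u (suc n))) (scale-*ₛ (s 0) (shift t) u n) ⟩
  s 0 *₃ (t 0 *₃ u (suc n)) +₃ (s 0 *₃ (shift t *ₛ u) n +₃ ((s′ *ₛ t) *ₛ u) n)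
    ≡⟨ sym (+-assoc (s 0 *₃ (t 0 *₃ u (suc n))) (s 0 *₃ (shift t *ₛ u) n) (((s′ *ₛ t) *ₛ u) n)) ⟩
  (s 0 *₃ (t 0 *₃ u (suc n)) +₃ s 0 *₃ (shift t *ₛ u) n) +₃ ((s′ *ₛ t) *ₛ u) n
    ≡⟨ cong₂ _+₃_ (sym (distribˡ (s 0) (t 0 *₃ u (suc n)) ((shift t *ₛ u) n))) (*ₛ-assoc s′ t u n) ⟩
  s 0 *₃ (t *ₛ u) (suc n) +₃ (s′ *ₛ (t *ₛ u)) n
    ∎
  where
  open ≡-Reasoning
  s′ = shift s
  s₀t′ = λ k → s 0 *₃ t (suc k)

series-isCommutativeRing : IsCommutativeRing _≈_ _+ₛ_ _*ₛ_ -ₛ_ 0ₛ 1ₛ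
series-isCommutativeRing = record
  { isRing = record
    { +-isAbelianGroup = record
      { isGroup = record
        { isMonoid = record
          { isSemigroup = record
            { isMagma = record
              { isEquivalence = record { refl = ≈-refl ; sym = ≈-sym ; trans = ≈-trans }
              ; ∙-cong = +ₛ-cong }
            ; assoc = λ s t u n → +-assoc (s n) (t n) (u n) }
          ; identity = (λ s n → +-identityˡ (s n)) , (λ s n → +-identityʳ (s n)) }
        ; inverse = (λ s n → -‿inverseˡ (s n)) , (λ s n → -‿inverseʳ (s n))
        ; ⁻¹-cong = λ e n → cong -₃_ (e n) }
      ; comm = λ s t n → +-comm (s n) (t n) }
    ; *-cong = *ₛ-cong
    ; *-assoc = *ₛ-assoc
    ; *-identity = *ₛ-identityˡ , λ s → ≈-trans (*ₛ-comm s 1ₛ) (*ₛ-identityˡ s)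
    ; distrib = *ₛ-distribˡ , *ₛ-distribʳ }
  ; *-comm = *ₛ-comm }

series-commutativeRing : CommutativeRing 0ℓ 0ℓ
series-commutativeRing = record { isCommutativeRing = series-isCommutativeRing }

series-setoid : Setoid 0ℓ 0ℓ
series-setoid = CommutativeRing.setoid series-commutativeRing

module SeriesReasoning = Relation.Binary.Reasoning.Setoid series-setoid

open CommutativeRing series-commutativeRing
  using () renaming (*-identityʳ to *ₛ-identityʳ; zeroʳ to *ₛ-zeroʳ)
open Setoid series-setoid using () renaming (reflexive to ≡⇒≈)

constant-homomorphism :
  𝔽₃-rawRing ACR.-Raw-AlmostCommutative⟶ ACR.fromCommutativeRing series-commutativeRing
constant-homomorphism = record
  { ⟦_⟧ = constant
  ; +-homo = λ { a b zero → refl ; a b (suc n) → refl }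
  ; *-homo = λ { a b zero → refl
               ; a b (suc n) → sym (trans (cong (a *₃ 𝟎 +₃_) (*ₛ-zeroˡ (constant b) n))
                                          (trans (+-identityʳ (a *₃ 𝟎)) (*-zeroʳ a))) }
  ; -‿homo = λ { a zero → refl ; a (suc n) → refl }
  ; 0-homo = λ { zero → refl ; (suc n) → refl }
  ; 1-homo = ≈-refl }

constant-≟ : ∀ a b → Maybe (constant a ≈ constant b)
constant-≟ a b with a ≟₃ b
... | yes refl = just ≈-refl
... | no _ = nothing

module SeriesSolver = Algebra.Solver.Ring
  𝔽₃-rawRing (ACR.fromCommutativeRing series-commutativeRing) constant-homomorphism constant-≟
open SeriesSolver using (solve; _:=_; _:+_; _:*_; _:-_; con)

data Position (e : ℕ) : ℕ → Set where
  below : ∀ {n} → n < e → Position e n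
  from : ∀ k → Position e (e + k)

position : ∀ e n → Position e n
position zero n = from n
position (suc e) zero = below (s≤s z≤n)
position (suc e) (suc n) with position e n
... | below n<e = below (s≤s n<e)
... | from k = from k

monomial-below : ∀ c {e n} → n < e → monomial c e n ≡ 𝟎
monomial-below c {suc e} {zero} _ = refl
monomial-below c {suc e} {suc n} (s≤s n<e) = monomial-below c n<e

monomial-≢ : ∀ c {e n} → n ≢ e → monomial c e n ≡ 𝟎
monomial-≢ c {zero} {zero} n≢e = ⊥-elim (n≢e refl)
monomial-≢ c {zero} {suc n} _ = refl
monomial-≢ c {suc e} {zero} _ = refl
monomial-≢ c {suc e} {suc n} n≢e = monomial-≢ c (λ n≡e → n≢e (cong suc n≡e))

monomial-≡ : ∀ c e → monomial c e e ≡ c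
monomial-≡ c zero = refl
monomial-≡ c (suc e) = monomial-≡ c e

monomial-*ₛ-below : ∀ c s {e n} → n < e → (monomial c e *ₛ s) n ≡ 𝟎
monomial-*ₛ-below c s {suc e} {zero} _ = refl
monomial-*ₛ-below c s {suc e} {suc n} (s≤s n<e) = monomial-*ₛ-below c s n<e

monomial-*ₛ-from : ∀ c s e k → (monomial c e *ₛ s) (e + k) ≡ c *₃ s k
monomial-*ₛ-from c s zero zero = refl
monomial-*ₛ-from c s zero (suc k) = trans (cong (c *₃ s (suc k) +₃_) (*ₛ-zeroˡ s k)) (+-identityʳ (c *₃ s (suc k)))
monomial-*ₛ-from c s (suc e) k = monomial-*ₛ-from c s e k

scale-monomial : ∀ a b f n → a *₃ monomial b f n ≡ monomial (a *₃ b) f n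
scale-monomial a b zero zero = refl
scale-monomial a b zero (suc n) = *-zeroʳ a
scale-monomial a b (suc f) zero = *-zeroʳ a
scale-monomial a b (suc f) (suc n) = scale-monomial a b f n

monomial-*ₛ-monomial : ∀ a b e f → monomial a e *ₛ monomial b f ≈ monomial (a *₃ b) (e + f)
monomial-*ₛ-monomial a b e f n with position e n
... | below n<e = trans (monomial-*ₛ-below a (monomial b f) n<e)
                        (sym (monomial-below (a *₃ b) (ℕ.<-≤-trans n<e (ℕ.m≤m+n e f))))
... | from k = begin
  (monomial a e *ₛ monomial b f) (e + k) ≡⟨ monomial-*ₛ-from a (monomial b f) e k ⟩
  a *₃ monomial b f k                    ≡⟨ scale-monomial a b f k ⟩
  monomial (a *₃ b) f k                  ≡⟨ sym (monomial-shift (a *₃ b) e f k) ⟩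
  monomial (a *₃ b) (e + f) (e + k)      ∎
  where
  open ≡-Reasoning
  monomial-shift : ∀ c e f k → monomial c (e + f) (e + k) ≡ monomial c f k
  monomial-shift c zero f k = refl
  monomial-shift c (suc e) f k = monomial-shift c e f k

q^-+ : ∀ a b → q^ (a + b) ≈ q^ a *ₛ q^ b
q^-+ a b = ≈-sym (monomial-*ₛ-monomial 𝟏 𝟏 a b)

infix 4 _≈[_]_
_≈[_]_ : Series → ℕ → Series → Set
s ≈[ K ] t = ∀ n → n < K → s n ≡ t n

≈⇒≈[] : ∀ {s t} K → s ≈ t → s ≈[ K ] t
≈⇒≈[] K e n _ = e n

≈[]-refl : ∀ {s K} → s ≈[ K ] s
≈[]-refl n _ = refl

≈[]-sym : ∀ {s t K} → s ≈[ K ] t → t ≈[ K ] s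
≈[]-sym e n p = sym (e n p)

≈[]-trans : ∀ {s t u K} → s ≈[ K ] t → t ≈[ K ] u → s ≈[ K ] u
≈[]-trans e f n p = trans (e n p) (f n p)

≈[]-setoid : ℕ → Setoid 0ℓ 0ℓ
≈[]-setoid K = record
  { _≈_ = _≈[ K ]_
  ; isEquivalence = record { refl = ≈[]-refl ; sym = ≈[]-sym ; trans = ≈[]-trans } }

module ≈[]-Reasoning (K : ℕ) = Relation.Binary.Reasoning.Setoid (≈[]-setoid K)

≈[]-weaken : ∀ {s t K L} → L ≤ K → s ≈[ K ] t → s ≈[ L ] t
≈[]-weaken L≤K e n n<L = e n (ℕ.<-≤-trans n<L L≤K)

+ₛ-cong[] : ∀ {s s′ t t′ K} → s ≈[ K ] s′ → t ≈[ K ] t′ → s +ₛ t ≈[ K ] s′ +ₛ t′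
+ₛ-cong[] e f n p = cong₂ _+₃_ (e n p) (f n p)

*ₛ-cong[] : ∀ {s s′ t t′ K} → s ≈[ K ] s′ → t ≈[ K ] t′ → s *ₛ t ≈[ K ] s′ *ₛ t′
*ₛ-cong[] {K = suc K} e f zero p = cong₂ _*₃_ (e 0 p) (f 0 p)
*ₛ-cong[] {K = suc K} e f (suc n) (s≤s n<K) =
  cong₂ _+₃_ (cong₂ _*₃_ (e 0 (s≤s z≤n)) (f (suc n) (s≤s n<K)))
             (*ₛ-cong[] {K = K} (λ i i<K → e (suc i) (s≤s i<K)) (λ i i<K → f i (ℕ.m<n⇒m<1+n i<K)) n n<K)

monomial-*ₛ-cong[] : ∀ c d {K s t} → s ≈[ K ] t → monomial c d *ₛ s ≈[ d + K ] monomial c d *ₛ t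
monomial-*ₛ-cong[] c d {K} {s} {t} e n n<d+K with position d n
... | below n<d = trans (monomial-*ₛ-below c s n<d) (sym (monomial-*ₛ-below c t n<d))
... | from k = begin
  (monomial c d *ₛ s) (d + k) ≡⟨ monomial-*ₛ-from c s d k ⟩
  c *₃ s k                    ≡⟨ cong (c *₃_) (e k (ℕ.+-cancelˡ-< d k K n<d+K)) ⟩
  c *₃ t k                    ≡⟨ sym (monomial-*ₛ-from c t d k) ⟩
  (monomial c d *ₛ t) (d + k) ∎
  where open ≡-Reasoning

-- Multicoloured partitions and the Euler product

-- waysFuel k ks f r = Σ_{j ≤ f, j·k ≤ r} ways ks (r ∸ j·k) is a copy of the helper `go` of `ways`.
waysFuel : ℕ → List ℕ → ℕ → ℕ → ℕ
waysFuelStep : (k : ℕ) → List ℕ → ℕ → (r : ℕ) → Dec (k ≤ r) → ℕ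
waysFuel k ks zero r = ways ks r
waysFuel k ks (suc f) r = waysFuelStep k ks f r (k ≤? r)
waysFuelStep k ks f r (yes _) = ways ks r + waysFuel k ks f (r ∸ k)
waysFuelStep k ks f r (no _) = ways ks r

waysFuelStep-unique : ∀ {k ks} {W : (f r : ℕ) → Dec (k ≤ r) → ℕ}
  → (∀ f r p → W f r (no p) ≡ ways ks r)
  → (∀ r p → W 0 r (yes p) ≡ ways ks r + ways ks (r ∸ k))
  → (∀ f r p → W (suc f) r (yes p) ≡ ways ks r + W f (r ∸ k) (k ≤? (r ∸ k)))
  → ∀ f r d → W f r d ≡ waysFuelStep k ks f r d
waysFuelStep-unique W-no W-yes₀ W-yes f r (no p) = W-no f r p
waysFuelStep-unique W-no W-yes₀ W-yes zero r (yes p) = W-yes₀ r p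
waysFuelStep-unique {k} {ks} {W} W-no W-yes₀ W-yes (suc f) r (yes p) =
  trans (W-yes f r p)
        (cong (ways ks r +_) (waysFuelStep-unique {W = W} W-no W-yes₀ W-yes f (r ∸ k) (k ≤? (r ∸ k))))

-- The helper `go` of `ways` is local to its clause and cannot be named. After the `with`
-- abstractions in `unfold` its own `with`-function occurs applied to variables only, so
-- unification can solve the hole in the type of `helper-agrees` with it.
ways-∷ : ∀ k ks n → ways (k ∷ ks) n ≡ waysFuel k ks n n
ways-∷ k ks = unfold
  where
  helper-agrees : ∀ P f r d → _ ≡ waysFuelStep k ks f r d
  helper-agrees P = waysFuelStep-unique (λ _ _ _ → refl) (λ _ _ → refl) (λ _ _ _ → refl)

  unfold : ∀ n → ways (k ∷ ks) n ≡ waysFuel k ks n n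
  unfold zero = refl
  unfold (suc zero) with k ≤? 1
  ... | yes _ = refl
  ... | no _ = refl
  unfold (suc (suc m)) with k ≤? suc (suc m)
  ... | no _ = refl
  ... | yes _ with suc (suc m) ∸ k
  ... | r with suc (suc m)
  ... | P with k ≤? r
  ... | d = cong (ways ks P +_) (helper-agrees P m r d)

waysFuel-irrelevant : ∀ {k} ks → 0 < k → ∀ f g {r} → r ≤ f → r ≤ g → waysFuel k ks f r ≡ waysFuel k ks g r
waysFuel-irrelevant ks 0<k zero zero _ _ = refl
waysFuel-irrelevant {k} ks 0<k zero (suc g) z≤n _ with k ≤? 0
... | yes k≤0 = ⊥-elim (ℕ.<⇒≱ 0<k k≤0)
... | no _ = refl
waysFuel-irrelevant {k} ks 0<k (suc f) zero _ z≤n with k ≤? 0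
... | yes k≤0 = ⊥-elim (ℕ.<⇒≱ 0<k k≤0)
... | no _ = refl
waysFuel-irrelevant {k} ks 0<k (suc f) (suc g) {r} r≤1+f r≤1+g with k ≤? r
... | no _ = refl
... | yes _ = cong (ways ks r +_) (waysFuel-irrelevant ks 0<k f g (r∸k≤ r≤1+f) (r∸k≤ r≤1+g))
  where
  r∸k≤ : ∀ {h} → r ≤ suc h → r ∸ k ≤ h
  r∸k≤ r≤1+h = ℕ.≤-trans (ℕ.∸-monoʳ-≤ r 0<k) (ℕ.∸-monoˡ-≤ 1 r≤1+h)

ways-∷-from : ∀ {k} ks → 0 < k → ∀ j → ways (k ∷ ks) (k + j) ≡ ways ks (k + j) + ways (k ∷ ks) j
ways-∷-from {suc k} ks 0<k j
  rewrite ways-∷ (suc k) ks (suc k + j) | ways-∷ (suc k) ks j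
  with suc k ≤? suc (k + j)
... | no k≰ = ⊥-elim (k≰ (s≤s (ℕ.m≤m+n k j)))
... | yes _ = cong (ways ks (suc k + j) +_) (begin
  waysFuel (suc k) ks (k + j) (k + j ∸ k) ≡⟨ cong (waysFuel (suc k) ks (k + j)) (ℕ.m+n∸m≡n k j) ⟩
  waysFuel (suc k) ks (k + j) j           ≡⟨ waysFuel-irrelevant ks 0<k (k + j) j (ℕ.m≤n+m j k) ℕ.≤-refl ⟩
  waysFuel (suc k) ks j j                 ∎)
  where open ≡-Reasoning

ways-∷-below : ∀ {k} ks {n} → n < k → ways (k ∷ ks) n ≡ ways ks n
ways-∷-below ks {zero} _ = refl
ways-∷-below {k} ks {suc n} n<k rewrite ways-∷ k ks (suc n) with k ≤? suc n
... | no _ = refl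
... | yes k≤n = ⊥-elim (ℕ.<⇒≱ n<k k≤n)

infix 8 1-q^_
1-q^_ : ℕ → Series
1-q^ k = 1ₛ +ₛ -ₛ q^ k

eulerProduct : List ℕ → Series
eulerProduct = foldr (λ k p → 1-q^ k *ₛ p) 1ₛ

waysSeries : List ℕ → Series
waysSeries ts n = [ ways ts n ]₃

waysSeries-∷ : ∀ {k} ks → 0 < k → waysSeries (k ∷ ks) *ₛ 1-q^ k ≈ waysSeries ks
waysSeries-∷ {k} ks 0<k = ≈-trans expand coefficients
  where
  W = waysSeries (k ∷ ks)
  expand : W *ₛ 1-q^ k ≈ W +ₛ -ₛ (q^ k *ₛ W)
  expand = solve 2 (λ w x → w :* (con 𝟏 :- x) := w :- x :* w) ≈-refl W (q^ k)
  coefficients : W +ₛ -ₛ (q^ k *ₛ W) ≈ waysSeries ks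
  coefficients n with position k n
  ... | below n<k = trans (cong₂ _+₃_ (cong [_]₃ (ways-∷-below ks n<k)) (cong -₃_ (monomial-*ₛ-below 𝟏 W n<k)))
                          (+-identityʳ (waysSeries ks n))
  ... | from j = begin
    W (k + j) +₃ -₃ (q^ k *ₛ W) (k + j)
      ≡⟨ cong₂ (λ x y → x +₃ -₃ y)
               (trans (cong [_]₃ (ways-∷-from ks 0<k j)) ([]₃-+ (ways ks (k + j)) (ways (k ∷ ks) j)))
               (monomial-*ₛ-from 𝟏 W k j) ⟩
    (waysSeries ks (k + j) +₃ W j) +₃ -₃ W j
      ≡⟨ +-assoc (waysSeries ks (k + j)) (W j) (-₃ W j) ⟩
    waysSeries ks (k + j) +₃ (W j +₃ -₃ W j)
      ≡⟨ cong (waysSeries ks (k + j) +₃_) (-‿inverseʳ (W j)) ⟩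
    waysSeries ks (k + j) +₃ 𝟎
      ≡⟨ +-identityʳ (waysSeries ks (k + j)) ⟩
    waysSeries ks (k + j) ∎
    where open ≡-Reasoning

waysSeries-*ₛ-eulerProduct : ∀ ts → All (0 <_) ts → waysSeries ts *ₛ eulerProduct ts ≈ 1ₛ
waysSeries-*ₛ-eulerProduct [] [] = ≈-trans (*ₛ-identityʳ (waysSeries [])) waysSeries-[]
  where
  waysSeries-[] : waysSeries [] ≈ 1ₛ
  waysSeries-[] zero = refl
  waysSeries-[] (suc n) = refl
waysSeries-*ₛ-eulerProduct (k ∷ ks) (0<k ∷ pos) = begin
  waysSeries (k ∷ ks) *ₛ (1-q^ k *ₛ eulerProduct ks) ≈⟨ ≈-sym (*ₛ-assoc _ _ _) ⟩
  (waysSeries (k ∷ ks) *ₛ 1-q^ k) *ₛ eulerProduct ks ≈⟨ *ₛ-cong (waysSeries-∷ ks 0<k) ≈-refl ⟩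
  waysSeries ks *ₛ eulerProduct ks                   ≈⟨ waysSeries-*ₛ-eulerProduct ks pos ⟩
  1ₛ                                                 ∎
  where open SeriesReasoning

-- A finite triple product identity

poch₂ : ℕ → ℕ → Series
poch₂ a zero = 1ₛ
poch₂ a (suc c) = 1-q^ a *ₛ poch₂ (2 + a) c

poch₂-+ : ∀ a c d → poch₂ a (c + d) ≈ poch₂ a c *ₛ poch₂ (2 * c + a) d
poch₂-+ a zero d = ≈-sym (*ₛ-identityˡ (poch₂ a d))
poch₂-+ a (suc c) d = begin
  1-q^ a *ₛ poch₂ (2 + a) (c + d)
    ≈⟨ *ₛ-cong ≈-refl (poch₂-+ (2 + a) c d) ⟩
  1-q^ a *ₛ (poch₂ (2 + a) c *ₛ poch₂ (2 * c + (2 + a)) d)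
    ≈⟨ ≈-sym (*ₛ-assoc _ _ _) ⟩
  poch₂ a (suc c) *ₛ poch₂ (2 * c + (2 + a)) d
    ≈⟨ *ₛ-cong ≈-refl (≡⇒≈ (cong (λ x → poch₂ x d) (exponent c a))) ⟩
  poch₂ a (suc c) *ₛ poch₂ (2 * suc c + a) d
    ∎
  where
  open SeriesReasoning
  exponent : ∀ c a → 2 * c + (2 + a) ≡ 2 * suc c + a
  exponent = solve-∀

poch₂-suc : ∀ a c → poch₂ a (suc c) ≈ poch₂ a c *ₛ 1-q^ (2 * c + a)
poch₂-suc a c = begin
  poch₂ a (suc c)                         ≈⟨ ≡⇒≈ (cong (poch₂ a) (ℕ.+-comm 1 c)) ⟩
  poch₂ a (c + 1)                         ≈⟨ poch₂-+ a c 1 ⟩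
  poch₂ a c *ₛ (1-q^ (2 * c + a) *ₛ 1ₛ)   ≈⟨ *ₛ-cong ≈-refl (*ₛ-identityʳ _) ⟩
  poch₂ a c *ₛ 1-q^ (2 * c + a)           ∎
  where open SeriesReasoning

-- scaledBinomial j m = [j+m, j]_{q²} · (q²; q²)_{j+m}: a Gaussian binomial without division.
scaledBinomial : ℕ → ℕ → Series
scaledBinomial j m = poch₂ (2 * suc m) j *ₛ poch₂ (2 * suc j) m

poch₂-even-suc : ∀ a c → poch₂ (2 * suc a) (suc c) ≈ 1-q^ (2 * suc a) *ₛ poch₂ (2 * suc (suc a)) c
poch₂-even-suc a c = *ₛ-cong ≈-refl (≡⇒≈ (cong (λ x → poch₂ x c) (exponent a)))
  where
  exponent : ∀ a → 2 + 2 * suc a ≡ 2 * suc (suc a)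
  exponent = solve-∀

scaledBinomial-zeroˡ : ∀ m → scaledBinomial 0 (suc m) ≈ 1-q^ (2 * suc m) *ₛ scaledBinomial 0 m
scaledBinomial-zeroˡ m = begin
  1ₛ *ₛ poch₂ 2 (suc m)              ≈⟨ ≈-trans (*ₛ-identityˡ _) (poch₂-suc 2 m) ⟩
  poch₂ 2 m *ₛ 1-q^ (2 * m + 2)      ≈⟨ *ₛ-comm _ _ ⟩
  1-q^ (2 * m + 2) *ₛ poch₂ 2 m      ≈⟨ *ₛ-cong (≡⇒≈ (cong 1-q^_ (exponent m))) (≈-sym (*ₛ-identityˡ _)) ⟩
  1-q^ (2 * suc m) *ₛ (1ₛ *ₛ poch₂ 2 m) ∎
  where
  open SeriesReasoning
  exponent : ∀ m → 2 * m + 2 ≡ 2 * suc m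
  exponent = solve-∀

scaledBinomial-zeroʳ : ∀ j → scaledBinomial (suc j) 0 ≈ 1-q^ (2 * suc j) *ₛ scaledBinomial j 0
scaledBinomial-zeroʳ j = begin
  poch₂ 2 (suc j) *ₛ 1ₛ              ≈⟨ ≈-trans (*ₛ-identityʳ _) (poch₂-suc 2 j) ⟩
  poch₂ 2 j *ₛ 1-q^ (2 * j + 2)      ≈⟨ *ₛ-comm _ _ ⟩
  1-q^ (2 * j + 2) *ₛ poch₂ 2 j      ≈⟨ *ₛ-cong (≡⇒≈ (cong 1-q^_ (exponent j))) (≈-sym (*ₛ-identityʳ _)) ⟩
  1-q^ (2 * suc j) *ₛ (poch₂ 2 j *ₛ 1ₛ) ∎
  where
  open SeriesReasoning
  exponent : ∀ j → 2 * j + 2 ≡ 2 * suc j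
  exponent = solve-∀

scaledBinomial-pascal-suc : ∀ j m → scaledBinomial (suc j) (suc m) ≈
  1-q^ (2 * (suc j + suc m)) *ₛ (scaledBinomial j (suc m) +ₛ q^ (2 * suc j) *ₛ scaledBinomial (suc j) m)
scaledBinomial-pascal-suc j m = begin
  poch₂ (2 * suc (suc m)) (suc j) *ₛ poch₂ (2 * suc (suc j)) (suc m)
    ≈⟨ *ₛ-cong (≈-trans (poch₂-suc _ j) (*ₛ-cong ≈-refl 1-q^n₁))
               (≈-trans (poch₂-suc _ m) (*ₛ-cong ≈-refl 1-q^n₂)) ⟩
  (X *ₛ (1ₛ +ₛ -ₛ (A *ₛ B))) *ₛ (Y *ₛ (1ₛ +ₛ -ₛ (A *ₛ B)))
    ≈⟨ solve 4 (λ x y a b → (x :* (con 𝟏 :- a :* b)) :* (y :* (con 𝟏 :- a :* b))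
                   := (con 𝟏 :- a :* b) :* (x :* ((con 𝟏 :- a) :* y) :+ a :* (((con 𝟏 :- b) :* x) :* y)))
             ≈-refl X Y A B ⟩
  (1ₛ +ₛ -ₛ (A *ₛ B)) *ₛ (X *ₛ (1-q^ (2 * suc j) *ₛ Y) +ₛ A *ₛ ((1-q^ (2 * suc m) *ₛ X) *ₛ Y))
    ≈⟨ ≈-sym (*ₛ-cong 1-q^n (+ₛ-cong (*ₛ-cong ≈-refl (poch₂-even-suc j m))
                                     (*ₛ-cong ≈-refl (*ₛ-cong (poch₂-even-suc m j) ≈-refl)))) ⟩
  1-q^ n *ₛ (scaledBinomial j (suc m) +ₛ A *ₛ scaledBinomial (suc j) m)
    ∎
  where
  open SeriesReasoning
  X = poch₂ (2 * suc (suc m)) j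
  Y = poch₂ (2 * suc (suc j)) m
  A = q^ (2 * suc j)
  B = q^ (2 * suc m)
  n = 2 * (suc j + suc m)
  1-q^n : 1-q^ n ≈ 1ₛ +ₛ -ₛ (A *ₛ B)
  1-q^n = +ₛ-cong ≈-refl (λ i → cong -₃_ (≈-trans (≡⇒≈ (cong q^ (exponent j m))) (q^-+ (2 * suc j) (2 * suc m)) i))
    where
    exponent : ∀ j m → 2 * (suc j + suc m) ≡ 2 * suc j + 2 * suc m
    exponent = solve-∀
  1-q^n₁ : 1-q^ (2 * j + 2 * suc (suc m)) ≈ 1ₛ +ₛ -ₛ (A *ₛ B)
  1-q^n₁ = ≈-trans (≡⇒≈ (cong 1-q^_ (exponent j m))) 1-q^n
    where
    exponent : ∀ j m → 2 * j + 2 * suc (suc m) ≡ 2 * (suc j + suc m)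
    exponent = solve-∀
  1-q^n₂ : 1-q^ (2 * m + 2 * suc (suc j)) ≈ 1ₛ +ₛ -ₛ (A *ₛ B)
  1-q^n₂ = ≈-trans (≡⇒≈ (cong 1-q^_ (exponent j m))) 1-q^n
    where
    exponent : ∀ j m → 2 * m + 2 * suc (suc j) ≡ 2 * (suc j + suc m)
    exponent = solve-∀

shiftˡ shiftʳ : (ℕ → ℕ → Series) → ℕ → ℕ → Series
shiftˡ g zero m = 0ₛ
shiftˡ g (suc j) m = g j m
shiftʳ g j zero = 0ₛ
shiftʳ g j (suc m) = g j m

scaledBinomial-pascal : ∀ j m → 0 < j + m →
  scaledBinomial j m ≈ 1-q^ (2 * (j + m)) *ₛ (shiftˡ scaledBinomial j m +ₛ q^ (2 * j) *ₛ shiftʳ scaledBinomial j m)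
scaledBinomial-pascal zero (suc m) _ = ≈-trans (scaledBinomial-zeroˡ m) (*ₛ-cong ≈-refl (≈-sym (*ₛ-identityˡ _)))
scaledBinomial-pascal (suc j) zero _ = begin
  scaledBinomial (suc j) 0
    ≈⟨ scaledBinomial-zeroʳ j ⟩
  1-q^ (2 * suc j) *ₛ scaledBinomial j 0
    ≈⟨ *ₛ-cong (≡⇒≈ (cong (λ n → 1-q^ (2 * n)) (sym (ℕ.+-identityʳ (suc j))))) (≈-sym drop-zero) ⟩
  1-q^ (2 * (suc j + 0)) *ₛ (scaledBinomial j 0 +ₛ q^ (2 * suc j) *ₛ 0ₛ)
    ∎
  where
  open SeriesReasoning
  drop-zero : scaledBinomial j 0 +ₛ q^ (2 * suc j) *ₛ 0ₛ ≈ scaledBinomial j 0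
  drop-zero n = trans (cong (scaledBinomial j 0 n +₃_) (*ₛ-zeroʳ (q^ (2 * suc j)) n)) (+-identityʳ _)
scaledBinomial-pascal (suc j) (suc m) _ = scaledBinomial-pascal-suc j m

antidiagonalSum : ℕ → (ℕ → ℕ → Series) → Series
antidiagonalSum zero g = g 0 0
antidiagonalSum (suc n) g = g 0 (suc n) +ₛ antidiagonalSum n (λ j m → g (suc j) m)

antidiagonalSum-cong : ∀ n {g h} → (∀ j m → j + m ≡ n → g j m ≈ h j m) → antidiagonalSum n g ≈ antidiagonalSum n h
antidiagonalSum-cong zero e = e 0 0 refl
antidiagonalSum-cong (suc n) e = +ₛ-cong (e 0 (suc n) refl) (antidiagonalSum-cong n (λ j m p → e (suc j) m (cong suc p)))

antidiagonalSum-cong[] : ∀ n {K g h} → (∀ j m → j + m ≡ n → g j m ≈[ K ] h j m) →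
                         antidiagonalSum n g ≈[ K ] antidiagonalSum n h
antidiagonalSum-cong[] zero e = e 0 0 refl
antidiagonalSum-cong[] (suc n) e = +ₛ-cong[] (e 0 (suc n) refl) (antidiagonalSum-cong[] n (λ j m p → e (suc j) m (cong suc p)))

antidiagonalSum-+ₛ : ∀ n g h → antidiagonalSum n (λ j m → g j m +ₛ h j m) ≈ antidiagonalSum n g +ₛ antidiagonalSum n h
antidiagonalSum-+ₛ zero g h = ≈-refl
antidiagonalSum-+ₛ (suc n) g h i =
  trans (cong (g 0 (suc n) i +₃ h 0 (suc n) i +₃_) (antidiagonalSum-+ₛ n (λ j → g (suc j)) (λ j → h (suc j)) i))
        (interchange (g 0 (suc n) i) (h 0 (suc n) i)
                     (antidiagonalSum n (λ j → g (suc j)) i) (antidiagonalSum n (λ j → h (suc j)) i))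

antidiagonalSum-*ₛ : ∀ n s g → antidiagonalSum n (λ j m → s *ₛ g j m) ≈ s *ₛ antidiagonalSum n g
antidiagonalSum-*ₛ zero s g = ≈-refl
antidiagonalSum-*ₛ (suc n) s g =
  ≈-trans (+ₛ-cong ≈-refl (antidiagonalSum-*ₛ n s (λ j → g (suc j)))) (≈-sym (*ₛ-distribˡ s _ _))

antidiagonalSum-shiftʳ : ∀ n g → antidiagonalSum (suc n) (shiftʳ g) ≈ antidiagonalSum n g
antidiagonalSum-shiftʳ zero g i = +-identityʳ (g 0 0 i)
antidiagonalSum-shiftʳ (suc n) g =
  +ₛ-cong ≈-refl (≈-trans (antidiagonalSum-cong (suc n) reindex) (antidiagonalSum-shiftʳ n (λ j → g (suc j))))
  where
  reindex : ∀ j m → j + m ≡ suc n → shiftʳ g (suc j) m ≈ shiftʳ (λ j → g (suc j)) j m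
  reindex j zero _ = ≈-refl
  reindex j (suc m) _ = ≈-refl

*ₛ-shiftˡ : ∀ (c : ℕ → Series) g j m → c j *ₛ shiftˡ g j m ≈ shiftˡ (λ j m → c (suc j) *ₛ g j m) j m
*ₛ-shiftˡ c g zero m = *ₛ-zeroʳ (c 0)
*ₛ-shiftˡ c g (suc j) m = ≈-refl

*ₛ-shiftʳ : ∀ (c : ℕ → Series) g j m → c j *ₛ shiftʳ g j m ≈ shiftʳ (λ j m → c j *ₛ g j m) j m
*ₛ-shiftʳ c g j zero = *ₛ-zeroʳ (c j)
*ₛ-shiftʳ c g j (suc m) = ≈-refl

antidiagonalSum-pascal : ∀ n (c : ℕ → Series) →
  antidiagonalSum (suc n) (λ j m → c j *ₛ scaledBinomial j m) ≈
  1-q^ (2 * suc n) *ₛ antidiagonalSum n (λ j m → (c (suc j) +ₛ c j *ₛ q^ (2 * j)) *ₛ scaledBinomial j m)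
antidiagonalSum-pascal n c = begin
  antidiagonalSum (suc n) (λ j m → c j *ₛ scaledBinomial j m)
    ≈⟨ antidiagonalSum-cong (suc n) pascal ⟩
  antidiagonalSum (suc n) (λ j m → F *ₛ (shiftˡ g₁ j m +ₛ shiftʳ g₂ j m))
    ≈⟨ antidiagonalSum-*ₛ (suc n) F (λ j m → shiftˡ g₁ j m +ₛ shiftʳ g₂ j m) ⟩
  F *ₛ antidiagonalSum (suc n) (λ j m → shiftˡ g₁ j m +ₛ shiftʳ g₂ j m)
    ≈⟨ *ₛ-cong ≈-refl (≈-trans (antidiagonalSum-+ₛ (suc n) (shiftˡ g₁) (shiftʳ g₂))
                               (+ₛ-cong ≈-refl (antidiagonalSum-shiftʳ n g₂))) ⟩
  F *ₛ (antidiagonalSum n g₁ +ₛ antidiagonalSum n g₂)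
    ≈⟨ *ₛ-cong ≈-refl (≈-trans (≈-sym (antidiagonalSum-+ₛ n g₁ g₂))
                               (antidiagonalSum-cong n (λ j m _ → ≈-sym (*ₛ-distribʳ (scaledBinomial j m) _ _)))) ⟩
  F *ₛ antidiagonalSum n (λ j m → (c (suc j) +ₛ c j *ₛ q^ (2 * j)) *ₛ scaledBinomial j m)
    ∎
  where
  open SeriesReasoning
  F = 1-q^ (2 * suc n)
  g₁ g₂ : ℕ → ℕ → Series
  g₁ j m = c (suc j) *ₛ scaledBinomial j m
  g₂ j m = (c j *ₛ q^ (2 * j)) *ₛ scaledBinomial j m
  pascal : ∀ j m → j + m ≡ suc n → c j *ₛ scaledBinomial j m ≈ F *ₛ (shiftˡ g₁ j m +ₛ shiftʳ g₂ j m)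
  pascal j m j+m≡1+n = begin
    c j *ₛ scaledBinomial j m
      ≈⟨ *ₛ-cong ≈-refl (≈-trans (scaledBinomial-pascal j m (subst (0 <_) (sym j+m≡1+n) (s≤s z≤n)))
                                 (*ₛ-cong (≡⇒≈ (cong (λ k → 1-q^ (2 * k)) j+m≡1+n)) ≈-refl)) ⟩
    c j *ₛ (F *ₛ (shiftˡ scaledBinomial j m +ₛ q^ (2 * j) *ₛ shiftʳ scaledBinomial j m))
      ≈⟨ solve 5 (λ c f x a y → c :* (f :* (x :+ a :* y)) := f :* (c :* x :+ (c :* a) :* y))
               ≈-refl (c j) F (shiftˡ scaledBinomial j m) (q^ (2 * j)) (shiftʳ scaledBinomial j m) ⟩
    F *ₛ (c j *ₛ shiftˡ scaledBinomial j m +ₛ (c j *ₛ q^ (2 * j)) *ₛ shiftʳ scaledBinomial j m)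
      ≈⟨ *ₛ-cong ≈-refl (+ₛ-cong (*ₛ-shiftˡ c scaledBinomial j m)
                                 (*ₛ-shiftʳ (λ j → c j *ₛ q^ (2 * j)) scaledBinomial j m)) ⟩
    F *ₛ (shiftˡ g₁ j m +ₛ shiftʳ g₂ j m)
      ∎

sign : ℕ → 𝔽₃
sign zero = 𝟏
sign (suc j) = -₃ sign j

-ₛ-monomial : ∀ a e → -ₛ monomial a e ≈ monomial (-₃ a) e
-ₛ-monomial a zero zero = refl
-ₛ-monomial a zero (suc n) = refl
-ₛ-monomial a (suc e) zero = refl
-ₛ-monomial a (suc e) (suc n) = -ₛ-monomial a e n

1-q^-*ₛ-monomial : ∀ k a e → 1-q^ k *ₛ monomial a e ≈ monomial a e +ₛ monomial (-₃ a) (k + e)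
1-q^-*ₛ-monomial k a e = begin
  1-q^ k *ₛ monomial a e
    ≈⟨ solve 2 (λ x m → (con 𝟏 :- x) :* m := m :- x :* m) ≈-refl (q^ k) (monomial a e) ⟩
  monomial a e +ₛ -ₛ (q^ k *ₛ monomial a e)
    ≈⟨ +ₛ-cong ≈-refl (λ n → cong -₃_ (monomial-*ₛ-monomial 𝟏 a k e n)) ⟩
  monomial a e +ₛ -ₛ monomial a (k + e)
    ≈⟨ +ₛ-cong ≈-refl (-ₛ-monomial a (k + e)) ⟩
  monomial a e +ₛ monomial (-₃ a) (k + e)
    ∎
  where
  open SeriesReasoning

monomial-*ₛ-q^ : ∀ a e k → monomial a e *ₛ q^ k ≈ monomial a (e + k)
monomial-*ₛ-q^ a e k =
  ≈-trans (monomial-*ₛ-monomial a 𝟏 e k) (≡⇒≈ (cong (λ b → monomial b (e + k)) (*-identityʳ a)))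

rotheTerm : ℕ → ℕ → Series
rotheTerm c j = monomial (sign j) (j * j + 2 * c * j)

rotheTerm-pascal : ∀ c j → rotheTerm c (suc j) +ₛ rotheTerm c j *ₛ q^ (2 * j) ≈ 1-q^ (1 + 2 * c) *ₛ rotheTerm (suc c) j
rotheTerm-pascal c j = begin
  rotheTerm c (suc j) +ₛ rotheTerm c j *ₛ q^ (2 * j)
    ≈⟨ +ₛ-cong (≡⇒≈ (cong (monomial (sign (suc j))) (exponent₁ c j)))
               (≈-trans (monomial-*ₛ-q^ (sign j) (j * j + 2 * c * j) (2 * j))
                        (≡⇒≈ (cong (monomial (sign j)) (exponent₂ c j)))) ⟩
  monomial (-₃ sign j) (1 + 2 * c + e) +ₛ monomial (sign j) e
    ≈⟨ (λ n → +-comm (monomial (-₃ sign j) (1 + 2 * c + e) n) (monomial (sign j) e n)) ⟩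
  monomial (sign j) e +ₛ monomial (-₃ sign j) (1 + 2 * c + e)
    ≈⟨ ≈-sym (1-q^-*ₛ-monomial (1 + 2 * c) (sign j) e) ⟩
  1-q^ (1 + 2 * c) *ₛ rotheTerm (suc c) j
    ∎
  where
  open SeriesReasoning
  e = j * j + 2 * suc c * j
  exponent₁ : ∀ c j → suc j * suc j + 2 * c * suc j ≡ 1 + 2 * c + (j * j + 2 * suc c * j)
  exponent₁ = solve-∀
  exponent₂ : ∀ c j → j * j + 2 * c * j + 2 * j ≡ j * j + 2 * suc c * j
  exponent₂ = solve-∀

-- Rothe's q-binomial theorem Σ_j (-1)^j q^(j² + 2cj) [b, j]_{q²} = (q^(2c+1); q²)_b,
-- multiplied by (q²; q²)_b.
rothe : ∀ b c → antidiagonalSum b (λ j m → rotheTerm c j *ₛ scaledBinomial j m) ≈ poch₂ (1 + 2 * c) b *ₛ poch₂ 2 b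
rothe zero c = ≈-trans (*ₛ-cong (≡⇒≈ (cong (monomial 𝟏) (ℕ.*-zeroʳ (2 * c)))) ≈-refl) (*ₛ-identityˡ _)
rothe (suc b) c = begin
  antidiagonalSum (suc b) (λ j m → rotheTerm c j *ₛ scaledBinomial j m)
    ≈⟨ antidiagonalSum-pascal b (rotheTerm c) ⟩
  F *ₛ antidiagonalSum b (λ j m → (rotheTerm c (suc j) +ₛ rotheTerm c j *ₛ q^ (2 * j)) *ₛ scaledBinomial j m)
    ≈⟨ *ₛ-cong ≈-refl (antidiagonalSum-cong b λ j m _ →
         ≈-trans (*ₛ-cong (rotheTerm-pascal c j) ≈-refl) (*ₛ-assoc _ _ _)) ⟩
  F *ₛ antidiagonalSum b (λ j m → G *ₛ (rotheTerm (suc c) j *ₛ scaledBinomial j m))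
    ≈⟨ *ₛ-cong ≈-refl (≈-trans (antidiagonalSum-*ₛ b G _) (*ₛ-cong ≈-refl (rothe b (suc c)))) ⟩
  F *ₛ (G *ₛ (poch₂ (1 + 2 * suc c) b *ₛ poch₂ 2 b))
    ≈⟨ solve 4 (λ f g p e → f :* (g :* (p :* e)) := (g :* p) :* (e :* f))
             ≈-refl F G (poch₂ (1 + 2 * suc c) b) (poch₂ 2 b) ⟩
  (G *ₛ poch₂ (1 + 2 * suc c) b) *ₛ (poch₂ 2 b *ₛ F)
    ≈⟨ *ₛ-cong (*ₛ-cong ≈-refl (≡⇒≈ (cong (λ x → poch₂ x b) (exponent₁ c))))
               (≈-sym (≈-trans (poch₂-suc 2 b) (*ₛ-cong ≈-refl (≡⇒≈ (cong 1-q^_ (exponent₂ b)))))) ⟩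
  poch₂ (1 + 2 * c) (suc b) *ₛ poch₂ 2 (suc b)
    ∎
  where
  open SeriesReasoning
  F = 1-q^ (2 * suc b)
  G = 1-q^ (1 + 2 * c)
  exponent₁ : ∀ c → 1 + 2 * suc c ≡ 2 + (1 + 2 * c)
  exponent₁ = solve-∀
  exponent₂ : ∀ b → 2 * b + 2 ≡ 2 * suc b
  exponent₂ = solve-∀

-- The summand (-1)^k q^(k²) of the triple product, with k = j - a running over -a, …, b.
jacobiTerm : ℕ → ℕ → Series
jacobiTerm a j = monomial (sign ∣ j - a ∣) (∣ j - a ∣ * ∣ j - a ∣)

sign-∣-∣-suc : ∀ j a → sign ∣ j - suc a ∣ ≡ -₃ sign ∣ j - a ∣
sign-∣-∣-suc zero a = refl
sign-∣-∣-suc (suc j) zero = trans (cong sign (ℕ.∣-∣-identityʳ j)) (sym (-₃-involutive (sign j)))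
  where
  -₃-involutive : ∀ a → -₃ -₃ a ≡ a
  -₃-involutive = from-yes (∀₃? λ a → -₃ -₃ a ≟₃ a)
sign-∣-∣-suc (suc j) (suc a) = sign-∣-∣-suc j a

square-∣-∣-suc : ∀ j a → ∣ j - suc a ∣ * ∣ j - suc a ∣ + 2 * j ≡ 1 + 2 * a + ∣ j - a ∣ * ∣ j - a ∣
square-∣-∣-suc zero a = arithmetic a
  where
  arithmetic : ∀ a → suc a * suc a + 0 ≡ 1 + 2 * a + a * a
  arithmetic = solve-∀
square-∣-∣-suc (suc j) zero rewrite ℕ.∣-∣-identityʳ j = arithmetic j
  where
  arithmetic : ∀ j → j * j + 2 * suc j ≡ 1 + 2 * 0 + suc j * suc j
  arithmetic = solve-∀
square-∣-∣-suc (suc j) (suc a) = begin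
  d′ * d′ + 2 * suc j       ≡⟨ shift₁ (d′ * d′) j ⟩
  d′ * d′ + 2 * j + 2       ≡⟨ cong (_+ 2) (square-∣-∣-suc j a) ⟩
  1 + 2 * a + d * d + 2     ≡⟨ shift₂ a (d * d) ⟩
  1 + 2 * suc a + d * d     ∎
  where
  open ≡-Reasoning
  d = ∣ j - a ∣
  d′ = ∣ j - suc a ∣
  shift₁ : ∀ x j → x + 2 * suc j ≡ x + 2 * j + 2
  shift₁ = solve-∀
  shift₂ : ∀ a x → 1 + 2 * a + x + 2 ≡ 1 + 2 * suc a + x
  shift₂ = solve-∀

jacobiTerm-pascal : ∀ a j → jacobiTerm a j +ₛ jacobiTerm (suc a) j *ₛ q^ (2 * j) ≈ 1-q^ (1 + 2 * a) *ₛ jacobiTerm a j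
jacobiTerm-pascal a j = begin
  jacobiTerm a j +ₛ jacobiTerm (suc a) j *ₛ q^ (2 * j)
    ≈⟨ +ₛ-cong ≈-refl (≈-trans (monomial-*ₛ-q^ (sign d′) (d′ * d′) (2 * j))
                               (≡⇒≈ (cong₂ monomial (sign-∣-∣-suc j a) (square-∣-∣-suc j a)))) ⟩
  monomial (sign d) (d * d) +ₛ monomial (-₃ sign d) (1 + 2 * a + d * d)
    ≈⟨ ≈-sym (1-q^-*ₛ-monomial (1 + 2 * a) (sign d) (d * d)) ⟩
  1-q^ (1 + 2 * a) *ₛ jacobiTerm a j
    ∎
  where
  open SeriesReasoning
  d = ∣ j - a ∣
  d′ = ∣ j - suc a ∣

-- A finite form of Jacobi's triple product identity at z = q, in base q².
finiteTripleProduct : ∀ a b →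
  antidiagonalSum (a + b) (λ j m → jacobiTerm a j *ₛ scaledBinomial j m) ≈ poch₂ 1 a *ₛ poch₂ 1 b *ₛ poch₂ 2 (a + b)
finiteTripleProduct zero b = begin
  antidiagonalSum b (λ j m → jacobiTerm 0 j *ₛ scaledBinomial j m)
    ≈⟨ antidiagonalSum-cong b (λ j m _ →
         *ₛ-cong (≡⇒≈ (cong₂ monomial (cong sign (ℕ.∣-∣-identityʳ j)) (exponent j))) ≈-refl) ⟩
  antidiagonalSum b (λ j m → rotheTerm 0 j *ₛ scaledBinomial j m)
    ≈⟨ rothe b 0 ⟩
  poch₂ 1 b *ₛ poch₂ 2 b
    ≈⟨ *ₛ-cong (≈-sym (*ₛ-identityˡ (poch₂ 1 b))) ≈-refl ⟩
  1ₛ *ₛ poch₂ 1 b *ₛ poch₂ 2 b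
    ∎
  where
  open SeriesReasoning
  exponent : ∀ j → ∣ j - 0 ∣ * ∣ j - 0 ∣ ≡ j * j + 2 * 0 * j
  exponent j rewrite ℕ.∣-∣-identityʳ j = sym (ℕ.+-identityʳ (j * j))
finiteTripleProduct (suc a) b = begin
  antidiagonalSum (suc (a + b)) (λ j m → jacobiTerm (suc a) j *ₛ scaledBinomial j m)
    ≈⟨ antidiagonalSum-pascal (a + b) (jacobiTerm (suc a)) ⟩
  F *ₛ antidiagonalSum (a + b) (λ j m → (jacobiTerm a j +ₛ jacobiTerm (suc a) j *ₛ q^ (2 * j)) *ₛ scaledBinomial j m)
    ≈⟨ *ₛ-cong ≈-refl (antidiagonalSum-cong (a + b) λ j m _ →
         ≈-trans (*ₛ-cong (jacobiTerm-pascal a j) ≈-refl) (*ₛ-assoc _ _ _)) ⟩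
  F *ₛ antidiagonalSum (a + b) (λ j m → G *ₛ (jacobiTerm a j *ₛ scaledBinomial j m))
    ≈⟨ *ₛ-cong ≈-refl (≈-trans (antidiagonalSum-*ₛ (a + b) G _) (*ₛ-cong ≈-refl (finiteTripleProduct a b))) ⟩
  F *ₛ (G *ₛ (poch₂ 1 a *ₛ poch₂ 1 b *ₛ poch₂ 2 (a + b)))
    ≈⟨ solve 5 (λ f g p r e → f :* (g :* (p :* r :* e)) := (p :* g) :* r :* (e :* f))
             ≈-refl F G (poch₂ 1 a) (poch₂ 1 b) (poch₂ 2 (a + b)) ⟩
  (poch₂ 1 a *ₛ G) *ₛ poch₂ 1 b *ₛ (poch₂ 2 (a + b) *ₛ F)
    ≈⟨ *ₛ-cong (*ₛ-cong (≈-sym (≈-trans (poch₂-suc 1 a) (*ₛ-cong ≈-refl (≡⇒≈ (cong 1-q^_ (exponent₁ a)))))) ≈-refl)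
               (≈-sym (≈-trans (poch₂-suc 2 (a + b)) (*ₛ-cong ≈-refl (≡⇒≈ (cong 1-q^_ (exponent₂ (a + b))))))) ⟩
  poch₂ 1 (suc a) *ₛ poch₂ 1 b *ₛ poch₂ 2 (suc (a + b))
    ∎
  where
  open SeriesReasoning
  F = 1-q^ (2 * suc (a + b))
  G = 1-q^ (1 + 2 * a)
  exponent₁ : ∀ a → 2 * a + 1 ≡ 1 + 2 * a
  exponent₁ = solve-∀
  exponent₂ : ∀ n → 2 * n + 2 ≡ 2 * suc n
  exponent₂ = solve-∀

-- Gauss's identity modulo q^(2N+1)

1-q^-≈[] : ∀ k → 1-q^ k ≈[ k ] 1ₛ
1-q^-≈[] k n n<k = trans (cong (λ x → 1ₛ n +₃ -₃ x) (monomial-below 𝟏 n<k)) (+-identityʳ (1ₛ n))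

poch₂-≈[] : ∀ a c → poch₂ a c ≈[ a ] 1ₛ
poch₂-≈[] a zero = ≈[]-refl
poch₂-≈[] a (suc c) =
  ≈[]-trans (*ₛ-cong[] (1-q^-≈[] a) (≈[]-weaken (ℕ.m≤n+m a 2) (poch₂-≈[] (2 + a) c)))
            (≈⇒≈[] a (*ₛ-identityˡ 1ₛ))

poch₂-extend : ∀ a c d → poch₂ a c ≈[ 2 * c + a ] poch₂ a (c + d)
poch₂-extend a c d = ≈[]-sym (≈[]-trans (≈⇒≈[] _ (poch₂-+ a c d))
  (≈[]-trans (*ₛ-cong[] ≈[]-refl (poch₂-≈[] (2 * c + a) d)) (≈⇒≈[] _ (*ₛ-identityʳ (poch₂ a c)))))

scaledBinomial-≈[] : ∀ j m → scaledBinomial j m ≈[ 2 * suc (j ⊓ m) ] 1ₛ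
scaledBinomial-≈[] j m = ≈[]-trans
  (*ₛ-cong[] (≈[]-weaken (ℕ.*-monoʳ-≤ 2 (s≤s (ℕ.m⊓n≤n j m))) (poch₂-≈[] (2 * suc m) j))
             (≈[]-weaken (ℕ.*-monoʳ-≤ 2 (s≤s (ℕ.m⊓n≤m j m))) (poch₂-≈[] (2 * suc j) m)))
  (≈⇒≈[] _ (*ₛ-identityˡ 1ₛ))

∣m+n-m∣≡n : ∀ m n → ∣ m + n - m ∣ ≡ n
∣m+n-m∣≡n m n = trans (ℕ.∣-∣-comm (m + n) m) (ℕ.∣m-m+n∣≡n m n)

⊓+∣-∣ : ∀ j m N → j + m ≡ N + N → j ⊓ m + ∣ j - N ∣ ≡ N
⊓+∣-∣ zero m N _ = refl
⊓+∣-∣ (suc j) zero (suc N) j+0≡N+N = begin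
  ∣ j - N ∣            ≡⟨ cong (λ x → ∣ x - N ∣) (ℕ.suc-injective (trans (sym (ℕ.+-identityʳ (suc j))) j+0≡N+N)) ⟩
  ∣ N + suc N - N ∣    ≡⟨ ∣m+n-m∣≡n N (suc N) ⟩
  suc N                ∎
  where open ≡-Reasoning
⊓+∣-∣ (suc j) (suc m) (suc N) j+m≡N+N = cong suc (⊓+∣-∣ j m N (ℕ.suc-injective (begin
  suc (j + m)  ≡⟨ sym (ℕ.+-suc j m) ⟩
  j + suc m    ≡⟨ ℕ.suc-injective j+m≡N+N ⟩
  N + suc N    ≡⟨ ℕ.+-suc N N ⟩
  suc (N + N)  ∎)))
  where open ≡-Reasoning

2*d≤d*d+1 : ∀ d → 2 * d ≤ d * d + 1
2*d≤d*d+1 zero = z≤n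
2*d≤d*d+1 (suc d) = begin
  2 * suc d              ≡⟨ arithmetic₁ d ⟩
  2 + 2 * d              ≤⟨ ℕ.m≤n+m (2 + 2 * d) (d * d) ⟩
  d * d + (2 + 2 * d)    ≡⟨ arithmetic₂ d ⟩
  suc d * suc d + 1      ∎
  where
  open ℕ.≤-Reasoning
  arithmetic₁ : ∀ d → 2 * suc d ≡ 2 + 2 * d
  arithmetic₁ = solve-∀
  arithmetic₂ : ∀ d → d * d + (2 + 2 * d) ≡ suc d * suc d + 1
  arithmetic₂ = solve-∀

jacobiTerm-*ₛ-scaledBinomial-≈[] : ∀ N j m → j + m ≡ N + N →
  jacobiTerm N j *ₛ scaledBinomial j m ≈[ suc (N + N) ] jacobiTerm N j
jacobiTerm-*ₛ-scaledBinomial-≈[] N j m j+m≡N+N =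
  ≈[]-trans (≈[]-weaken bound (monomial-*ₛ-cong[] (sign d) (d * d) (scaledBinomial-≈[] j m)))
            (≈⇒≈[] _ (*ₛ-identityʳ (jacobiTerm N j)))
  where
  d = ∣ j - N ∣
  u = j ⊓ m
  bound : suc (N + N) ≤ d * d + 2 * suc u
  bound = begin
    suc (N + N)                  ≡⟨ cong (λ x → suc (x + x)) (sym (⊓+∣-∣ j m N j+m≡N+N)) ⟩
    suc ((u + d) + (u + d))      ≡⟨ arithmetic₁ u d ⟩
    2 * d + (1 + 2 * u)          ≤⟨ ℕ.+-monoˡ-≤ (1 + 2 * u) (2*d≤d*d+1 d) ⟩
    (d * d + 1) + (1 + 2 * u)    ≡⟨ arithmetic₂ u d ⟩
    d * d + 2 * suc u            ∎
    where
    open ℕ.≤-Reasoning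
    arithmetic₁ : ∀ u d → suc ((u + d) + (u + d)) ≡ 2 * d + (1 + 2 * u)
    arithmetic₁ = solve-∀
    arithmetic₂ : ∀ u d → (d * d + 1) + (1 + 2 * u) ≡ d * d + 2 * suc u
    arithmetic₂ = solve-∀

thetaTerm : ℕ → ℕ → Series
thetaTerm c k = monomial (sign k) (c * (k * k))

-- theta c N = Σ_{|k| ≤ N} (-1)^k q^(c k²), a truncation of φ(-q^c).
theta : ℕ → ℕ → Series
theta c zero = 1ₛ
theta c (suc N) = thetaTerm c (suc N) +ₛ thetaTerm c (suc N) +ₛ theta c N

antidiagonalSum-ends : ∀ n g →
  antidiagonalSum (suc (suc n)) g ≈ g 0 (suc (suc n)) +ₛ g (suc (suc n)) 0 +ₛ antidiagonalSum n (λ j m → g (suc j) (suc m))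
antidiagonalSum-ends zero g = solve 3 (λ a b c → a :+ (b :+ c) := a :+ c :+ b) ≈-refl (g 0 2) (g 1 1) (g 2 0)
antidiagonalSum-ends (suc n) g = begin
  g 0 (3 + n) +ₛ antidiagonalSum (2 + n) g′
    ≈⟨ +ₛ-cong (≈-refl {g 0 (3 + n)}) (antidiagonalSum-ends n g′) ⟩
  g 0 (3 + n) +ₛ (g 1 (2 + n) +ₛ g (3 + n) 0 +ₛ rest)
    ≈⟨ solve 4 (λ a b c d → a :+ (b :+ c :+ d) := a :+ c :+ (b :+ d))
             ≈-refl (g 0 (3 + n)) (g 1 (2 + n)) (g (3 + n) 0) rest ⟩
  g 0 (3 + n) +ₛ g (3 + n) 0 +ₛ (g 1 (2 + n) +ₛ rest)
    ∎
  where
  open SeriesReasoning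
  g′ = λ j m → g (suc j) m
  rest = antidiagonalSum n (λ j m → g (suc (suc j)) (suc m))

jacobiTerms≈theta : ∀ N → antidiagonalSum (N + N) (λ j _ → jacobiTerm N j) ≈ theta 1 N
jacobiTerms≈theta zero = ≈-refl
jacobiTerms≈theta (suc N) = begin
  antidiagonalSum (suc N + suc N) (λ j _ → jacobiTerm (suc N) j)
    ≈⟨ ≡⇒≈ (cong (λ n → antidiagonalSum n (λ j _ → jacobiTerm (suc N) j)) (cong suc (ℕ.+-suc N N))) ⟩
  antidiagonalSum (suc (suc (N + N))) (λ j _ → jacobiTerm (suc N) j)
    ≈⟨ antidiagonalSum-ends (N + N) (λ j _ → jacobiTerm (suc N) j) ⟩
  jacobiTerm (suc N) 0 +ₛ jacobiTerm (suc N) (suc (suc (N + N))) +ₛ antidiagonalSum (N + N) (λ j _ → jacobiTerm N j)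
    ≈⟨ +ₛ-cong (+ₛ-cong first last) (jacobiTerms≈theta N) ⟩
  theta 1 (suc N)
    ∎
  where
  open SeriesReasoning
  distance : ∣ suc (N + N) - N ∣ ≡ suc N
  distance = trans (cong (λ x → ∣ x - N ∣) (sym (ℕ.+-suc N N))) (∣m+n-m∣≡n N (suc N))
  first : jacobiTerm (suc N) 0 ≈ thetaTerm 1 (suc N)
  first = ≡⇒≈ (cong (monomial (sign (suc N))) (sym (ℕ.*-identityˡ (suc N * suc N))))
  last : jacobiTerm (suc N) (suc (suc (N + N))) ≈ thetaTerm 1 (suc N)
  last = ≡⇒≈ (cong₂ monomial (cong sign distance) (trans (cong₂ _*_ distance distance) (sym (ℕ.*-identityˡ _))))

-- (q; q²)_N² (q²; q²)_N, a truncation of the product side of Gauss's identity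
-- φ(-q) = (q; q)_∞ / (-q; q)_∞ = (q; q²)_∞² (q²; q²)_∞.
gaussProduct : ℕ → Series
gaussProduct N = poch₂ 1 N *ₛ poch₂ 1 N *ₛ poch₂ 2 N

gaussProduct≈theta : ∀ N → gaussProduct N ≈[ suc (N + N) ] theta 1 N
gaussProduct≈theta N = begin
  poch₂ 1 N *ₛ poch₂ 1 N *ₛ poch₂ 2 N
    ≈⟨ *ₛ-cong[] ≈[]-refl (≈[]-weaken (bound N) (poch₂-extend 2 N N)) ⟩
  poch₂ 1 N *ₛ poch₂ 1 N *ₛ poch₂ 2 (N + N)
    ≈⟨ ≈⇒≈[] _ (≈-sym (finiteTripleProduct N N)) ⟩
  antidiagonalSum (N + N) (λ j m → jacobiTerm N j *ₛ scaledBinomial j m)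
    ≈⟨ antidiagonalSum-cong[] (N + N) (jacobiTerm-*ₛ-scaledBinomial-≈[] N) ⟩
  antidiagonalSum (N + N) (λ j _ → jacobiTerm N j)
    ≈⟨ ≈⇒≈[] _ (jacobiTerms≈theta N) ⟩
  theta 1 N
    ∎
  where
  open ≈[]-Reasoning (suc (N + N))
  bound : ∀ N → suc (N + N) ≤ 2 * N + 2
  bound N = ℕ.≤-trans (ℕ.n≤1+n _) (ℕ.≤-reflexive (arithmetic N))
    where
    arithmetic : ∀ N → suc (suc (N + N)) ≡ 2 * N + 2
    arithmetic = solve-∀

eulerProduct-++ : ∀ xs ys → eulerProduct (xs ++ ys) ≈ eulerProduct xs *ₛ eulerProduct ys
eulerProduct-++ [] ys = ≈-sym (*ₛ-identityˡ (eulerProduct ys))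
eulerProduct-++ (x ∷ xs) ys =
  ≈-trans (*ₛ-cong ≈-refl (eulerProduct-++ xs ys)) (≈-sym (*ₛ-assoc (1-q^ x) (eulerProduct xs) (eulerProduct ys)))

eulerProduct-replicate-≈[] : ∀ c k → eulerProduct (replicate c k) ≈[ k ] 1ₛ
eulerProduct-replicate-≈[] zero k = ≈[]-refl
eulerProduct-replicate-≈[] (suc c) k =
  ≈[]-trans (*ₛ-cong[] (1-q^-≈[] k) (eulerProduct-replicate-≈[] c k)) (≈⇒≈[] k (*ₛ-identityˡ 1ₛ))

eulerProduct-partTypes-extend : ∀ r s T d → eulerProduct (partTypes r s T) ≈[ suc T ] eulerProduct (partTypes r s (T + d))
eulerProduct-partTypes-extend r s T zero =
  ≈⇒≈[] _ (≡⇒≈ (cong (λ L → eulerProduct (partTypes r s L)) (sym (ℕ.+-identityʳ T))))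
eulerProduct-partTypes-extend r s T (suc d) = begin
  eulerProduct (partTypes r s T)
    ≈⟨ eulerProduct-partTypes-extend r s T d ⟩
  eulerProduct (partTypes r s (T + d))
    ≈⟨ ≈⇒≈[] _ (≈-sym (*ₛ-identityʳ _)) ⟩
  eulerProduct (partTypes r s (T + d)) *ₛ 1ₛ
    ≈⟨ *ₛ-cong[] ≈[]-refl (≈[]-sym (≈[]-weaken (s≤s (ℕ.m≤m+n T d))
                                   (eulerProduct-replicate-≈[] (colours r s (suc (T + d))) (suc (T + d))))) ⟩
  eulerProduct (partTypes r s (T + d)) *ₛ eulerProduct (replicate (colours r s (suc (T + d))) (suc (T + d)))
    ≈⟨ ≈⇒≈[] _ (≈-sym (eulerProduct-++ (partTypes r s (T + d)) _)) ⟩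
  eulerProduct (partTypes r s (suc (T + d)))
    ≈⟨ ≈⇒≈[] _ (≡⇒≈ (cong (λ L → eulerProduct (partTypes r s L)) (sym (ℕ.+-suc T d)))) ⟩
  eulerProduct (partTypes r s (T + suc d))
    ∎
  where open ≈[]-Reasoning (suc T)

partTypes-positive : ∀ r s T → All (0 <_) (partTypes r s T)
partTypes-positive r s zero = []
partTypes-positive r s (suc T) = ++⁺ (partTypes-positive r s T) (replicate⁺ (colours r s (suc T)) (s≤s z≤n))

isEven-double : ∀ N → isEven (N + N) ≡ true
isEven-double zero = refl
isEven-double (suc N) rewrite ℕ.+-suc N N = isEven-double N

isEven-double+1 : ∀ N → isEven (suc (N + N)) ≡ false
isEven-double+1 zero = refl
isEven-double+1 (suc N) rewrite ℕ.+-suc N N = isEven-double+1 N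

eulerProduct-partTypes-double : ∀ N → eulerProduct (partTypes 2 4 (N + N)) ≈ gaussProduct N *ₛ gaussProduct N
eulerProduct-partTypes-double zero =
  solve 0 (con 𝟏 := (con 𝟏 :* con 𝟏 :* con 𝟏) :* (con 𝟏 :* con 𝟏 :* con 𝟏)) ≈-refl
eulerProduct-partTypes-double (suc N) = begin
  eulerProduct (partTypes 2 4 (suc N + suc N))
    ≈⟨ ≡⇒≈ (cong eulerProduct partTypes-step) ⟩
  eulerProduct ((partTypes 2 4 (N + N) ++ replicate 4 k₁) ++ replicate 2 k₂)
    ≈⟨ ≈-trans (eulerProduct-++ (partTypes 2 4 (N + N) ++ replicate 4 k₁) (replicate 2 k₂))
              (*ₛ-cong (eulerProduct-++ (partTypes 2 4 (N + N)) (replicate 4 k₁)) ≈-refl) ⟩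
  eulerProduct (partTypes 2 4 (N + N)) *ₛ eulerProduct (replicate 4 k₁) *ₛ eulerProduct (replicate 2 k₂)
    ≈⟨ *ₛ-cong (*ₛ-cong (eulerProduct-partTypes-double N) ≈-refl) ≈-refl ⟩
  (gaussProduct N *ₛ gaussProduct N) *ₛ eulerProduct (replicate 4 k₁) *ₛ eulerProduct (replicate 2 k₂)
    ≈⟨ solve 4 (λ o e f g → (((o :* o :* e) :* (o :* o :* e)) :* (f :* (f :* (f :* (f :* con 𝟏))))) :* (g :* (g :* con 𝟏))
                          := ((o :* f) :* (o :* f) :* (e :* g)) :* ((o :* f) :* (o :* f) :* (e :* g)))
             ≈-refl (poch₂ 1 N) (poch₂ 2 N) (1-q^ k₁) (1-q^ k₂) ⟩
  ((poch₂ 1 N *ₛ 1-q^ k₁) *ₛ (poch₂ 1 N *ₛ 1-q^ k₁) *ₛ (poch₂ 2 N *ₛ 1-q^ k₂)) *ₛ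
  ((poch₂ 1 N *ₛ 1-q^ k₁) *ₛ (poch₂ 1 N *ₛ 1-q^ k₁) *ₛ (poch₂ 2 N *ₛ 1-q^ k₂))
    ≈⟨ ≈-sym (*ₛ-cong gaussProduct-suc gaussProduct-suc) ⟩
  gaussProduct (suc N) *ₛ gaussProduct (suc N)
    ∎
  where
  open SeriesReasoning
  k₁ = suc (N + N)
  k₂ = suc k₁
  partTypes-step : partTypes 2 4 (suc N + suc N) ≡ (partTypes 2 4 (N + N) ++ replicate 4 k₁) ++ replicate 2 k₂
  partTypes-step rewrite ℕ.+-suc N N | isEven-double+1 N | isEven-double N = refl
  odd-step : poch₂ 1 (suc N) ≈ poch₂ 1 N *ₛ 1-q^ k₁
  odd-step = ≈-trans (poch₂-suc 1 N) (*ₛ-cong ≈-refl (≡⇒≈ (cong 1-q^_ (arithmetic N))))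
    where
    arithmetic : ∀ N → 2 * N + 1 ≡ suc (N + N)
    arithmetic = solve-∀
  even-step : poch₂ 2 (suc N) ≈ poch₂ 2 N *ₛ 1-q^ k₂
  even-step = ≈-trans (poch₂-suc 2 N) (*ₛ-cong ≈-refl (≡⇒≈ (cong 1-q^_ (arithmetic N))))
    where
    arithmetic : ∀ N → 2 * N + 2 ≡ suc (suc (N + N))
    arithmetic = solve-∀
  gaussProduct-suc :
    gaussProduct (suc N) ≈ (poch₂ 1 N *ₛ 1-q^ k₁) *ₛ (poch₂ 1 N *ₛ 1-q^ k₁) *ₛ (poch₂ 2 N *ₛ 1-q^ k₂)
  gaussProduct-suc = *ₛ-cong (*ₛ-cong odd-step odd-step) even-step

eulerProduct-partTypes≈theta² : ∀ T → eulerProduct (partTypes 2 4 T) ≈[ suc T ] theta 1 T *ₛ theta 1 T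
eulerProduct-partTypes≈theta² T = begin
  eulerProduct (partTypes 2 4 T)       ≈⟨ eulerProduct-partTypes-extend 2 4 T T ⟩
  eulerProduct (partTypes 2 4 (T + T)) ≈⟨ ≈⇒≈[] _ (eulerProduct-partTypes-double T) ⟩
  gaussProduct T *ₛ gaussProduct T     ≈⟨ ≈[]-weaken (s≤s (ℕ.m≤m+n T T))
                                            (*ₛ-cong[] (gaussProduct≈theta T) (gaussProduct≈theta T)) ⟩
  theta 1 T *ₛ theta 1 T               ∎
  where open ≈[]-Reasoning (suc T)

-- Frobenius and Atkin's operator U₃

sign-+ : ∀ m n → sign (m + n) ≡ sign m *₃ sign n
sign-+ zero n = sym (*-identityˡ (sign n))
sign-+ (suc m) n = trans (cong -₃_ (sign-+ m n)) (-₃-*₃ (sign m) (sign n))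
  where
  -₃-*₃ : ∀ a b → -₃ (a *₃ b) ≡ -₃ a *₃ b
  -₃-*₃ = from-yes (∀₃? λ a → ∀₃? λ b → -₃ (a *₃ b) ≟₃ -₃ a *₃ b)

sign-3* : ∀ m → sign (3 * m) ≡ sign m
sign-3* m = begin
  sign (m + (m + (m + 0)))              ≡⟨ trans (sign-+ m (m + (m + 0)))
                                                 (cong (sign m *₃_) (trans (sign-+ m (m + 0)) (cong (sign m *₃_) (sign-+ m 0)))) ⟩
  sign m *₃ (sign m *₃ (sign m *₃ 𝟏))    ≡⟨ cong (λ x → sign m *₃ (sign m *₃ x)) (*-identityʳ (sign m)) ⟩
  sign m *₃ (sign m *₃ sign m)           ≡⟨ sym (*-assoc (sign m) (sign m) (sign m)) ⟩
  sign m *₃ sign m *₃ sign m             ≡⟨ cube₃ (sign m) ⟩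
  sign m                                 ∎
  where open ≡-Reasoning

cube : Series → Series
cube s = s *ₛ s *ₛ s

-- Holds because the binomial coefficients 3 vanish in 𝔽₃.
cube-+ₛ : ∀ s t → cube (s +ₛ t) ≈ cube s +ₛ cube t
cube-+ₛ = solve 2 (λ s t → (s :+ t) :* (s :+ t) :* (s :+ t) := s :* s :* s :+ t :* t :* t) ≈-refl

cube-monomial : ∀ a e → cube (monomial a e) ≈ monomial a (3 * e)
cube-monomial a e = begin
  monomial a e *ₛ monomial a e *ₛ monomial a e   ≈⟨ *ₛ-cong (monomial-*ₛ-monomial a a e e) ≈-refl ⟩
  monomial (a *₃ a) (e + e) *ₛ monomial a e      ≈⟨ monomial-*ₛ-monomial (a *₃ a) a (e + e) e ⟩
  monomial (a *₃ a *₃ a) (e + e + e)             ≈⟨ ≡⇒≈ (cong₂ monomial (cube₃ a) (arithmetic e)) ⟩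
  monomial a (3 * e)                             ∎
  where
  open SeriesReasoning
  arithmetic : ∀ e → e + e + e ≡ 3 * e
  arithmetic = solve-∀

thetaTerm-cube : ∀ k → cube (thetaTerm 1 k) ≈ thetaTerm 3 k
thetaTerm-cube k =
  ≈-trans (cube-monomial (sign k) (1 * (k * k))) (≡⇒≈ (cong (λ e → monomial (sign k) (3 * e)) (ℕ.*-identityˡ (k * k))))

theta-cube : ∀ N → cube (theta 1 N) ≈ theta 3 N
theta-cube zero = ≈-trans (*ₛ-cong (*ₛ-identityˡ 1ₛ) ≈-refl) (*ₛ-identityˡ 1ₛ)
theta-cube (suc N) = begin
  cube (x +ₛ x +ₛ theta 1 N)
    ≈⟨ ≈-trans (cube-+ₛ (x +ₛ x) (theta 1 N)) (+ₛ-cong (cube-+ₛ x x) ≈-refl) ⟩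
  cube x +ₛ cube x +ₛ cube (theta 1 N)
    ≈⟨ +ₛ-cong (+ₛ-cong (thetaTerm-cube (suc N)) (thetaTerm-cube (suc N))) (theta-cube N) ⟩
  theta 3 (suc N)
    ∎
  where
  open SeriesReasoning
  x = thetaTerm 1 (suc N)

theta-extend : ∀ c → 0 < c → ∀ n d → theta c n ≈[ suc n ] theta c (n + d)
theta-extend c 0<c n zero = ≈⇒≈[] _ (≡⇒≈ (cong (theta c) (sym (ℕ.+-identityʳ n))))
theta-extend c 0<c n (suc d) = begin
  theta c n                    ≈⟨ theta-extend c 0<c n d ⟩
  theta c (n + d)              ≈⟨ new-terms-vanish ⟩
  theta c (suc (n + d))        ≈⟨ ≈⇒≈[] _ (≡⇒≈ (cong (theta c) (sym (ℕ.+-suc n d)))) ⟩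
  theta c (n + suc d)          ∎
  where
  open ≈[]-Reasoning (suc n)
  k = suc (n + d)
  n<exponent : n < c * (k * k)
  n<exponent = ℕ.<-≤-trans (s≤s (ℕ.m≤m+n n d)) (ℕ.≤-trans (ℕ.m≤m*n k k) (ℕ.m≤n*m (k * k) c))
    where instance _ = >-nonZero 0<c
  new-terms-vanish : theta c (n + d) ≈[ suc n ] theta c (suc (n + d))
  new-terms-vanish i i<1+n = cong₂ (λ x y → x +₃ y +₃ theta c (n + d) i) (sym vanish) (sym vanish)
    where
    vanish : thetaTerm c k i ≡ 𝟎
    vanish = monomial-below (sign k) (ℕ.≤-<-trans (ℕ.≤-pred i<1+n) n<exponent)

3*m≢1+3*n : ∀ m n → 3 * m ≢ suc (3 * n)
3*m≢1+3*n m n 3m≡1+3n with trans (sym ([3*m]₃≡𝟎 m)) (trans (cong [_]₃ 3m≡1+3n) (cong (𝟏 +₃_) ([3*m]₃≡𝟎 n)))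
... | ()

U₃ : Series → Series
U₃ s m = s (3 * m)

U₃-cong : ∀ {s t} → s ≈ t → U₃ s ≈ U₃ t
U₃-cong e m = e (3 * m)

U₃-≈[] : ∀ {s t} m → s ≈[ suc (3 * m) ] t → U₃ s ≈[ suc m ] U₃ t
U₃-≈[] m e i i<1+m = e (3 * i) (s≤s (ℕ.*-monoʳ-≤ 3 (ℕ.≤-pred i<1+m)))

U₃-monomial-3* : ∀ c e → U₃ (monomial c (3 * e)) ≈ monomial c e
U₃-monomial-3* c e m with m ℕ.≟ e
... | yes refl = trans (monomial-≡ c (3 * m)) (sym (monomial-≡ c m))
... | no m≢e = trans (monomial-≢ c (λ 3m≡3e → m≢e (ℕ.*-cancelˡ-≡ m e 3 3m≡3e))) (sym (monomial-≢ c m≢e))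

U₃-monomial-1+3* : ∀ c e → U₃ (monomial c (suc (3 * e))) ≈ 0ₛ
U₃-monomial-1+3* c e m = monomial-≢ c (3*m≢1+3*n m e)

U₃-monomial-3*-*ₛ : ∀ c e s → U₃ (monomial c (3 * e) *ₛ s) ≈ monomial c e *ₛ U₃ s
U₃-monomial-3*-*ₛ c e s m with position e m
... | below m<e = trans (monomial-*ₛ-below c s (ℕ.*-monoʳ-< 3 m<e)) (sym (monomial-*ₛ-below c (U₃ s) m<e))
... | from k = begin
  (monomial c (3 * e) *ₛ s) (3 * (e + k))     ≡⟨ cong (monomial c (3 * e) *ₛ s) (ℕ.*-distribˡ-+ 3 e k) ⟩
  (monomial c (3 * e) *ₛ s) (3 * e + 3 * k)   ≡⟨ monomial-*ₛ-from c s (3 * e) (3 * k) ⟩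
  c *₃ s (3 * k)                              ≡⟨ sym (monomial-*ₛ-from c (U₃ s) e k) ⟩
  (monomial c e *ₛ U₃ s) (e + k)              ∎
  where open ≡-Reasoning

U₃-theta3-*ₛ : ∀ N s → U₃ (theta 3 N *ₛ s) ≈ theta 1 N *ₛ U₃ s
U₃-theta3-*ₛ zero s = ≈-trans (U₃-cong (*ₛ-identityˡ s)) (≈-sym (*ₛ-identityˡ (U₃ s)))
U₃-theta3-*ₛ (suc N) s = begin
  U₃ ((y +ₛ y +ₛ theta 3 N) *ₛ s)
    ≈⟨ U₃-cong (solve 3 (λ s y θ → (y :+ y :+ θ) :* s := y :* s :+ y :* s :+ θ :* s) ≈-refl s y (theta 3 N)) ⟩
  U₃ (y *ₛ s) +ₛ U₃ (y *ₛ s) +ₛ U₃ (theta 3 N *ₛ s)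
    ≈⟨ +ₛ-cong (+ₛ-cong U₃[y*s] U₃[y*s]) (U₃-theta3-*ₛ N s) ⟩
  x *ₛ U₃ s +ₛ x *ₛ U₃ s +ₛ theta 1 N *ₛ U₃ s
    ≈⟨ solve 3 (λ u x θ → x :* u :+ x :* u :+ θ :* u := (x :+ x :+ θ) :* u) ≈-refl (U₃ s) x (theta 1 N) ⟩
  theta 1 (suc N) *ₛ U₃ s
    ∎
  where
  open SeriesReasoning
  K = suc N * suc N
  x = thetaTerm 1 (suc N)
  y = thetaTerm 3 (suc N)
  U₃[y*s] : U₃ (y *ₛ s) ≈ x *ₛ U₃ s
  U₃[y*s] = ≈-trans (U₃-monomial-3*-*ₛ (sign (suc N)) K s)
                    (*ₛ-cong (≡⇒≈ (cong (monomial (sign (suc N))) (sym (ℕ.*-identityˡ K)))) ≈-refl)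

U₃-theta : ∀ M → U₃ (theta 1 (3 * M)) ≈ theta 3 M
U₃-theta zero = U₃-monomial-3* 𝟏 0
U₃-theta (suc M) = begin
  U₃ (theta 1 (3 * suc M))
    ≈⟨ U₃-cong (≡⇒≈ (cong (theta 1) (arithmetic₀ M))) ⟩
  U₃ (t₃ +ₛ t₃ +ₛ (t₂ +ₛ t₂ +ₛ (t₁ +ₛ t₁ +ₛ theta 1 (3 * M))))
    ≈⟨ +ₛ-cong (+ₛ-cong U₃t₃ U₃t₃) (+ₛ-cong (+ₛ-cong U₃t₂ U₃t₂) (+ₛ-cong (+ₛ-cong U₃t₁ U₃t₁) (U₃-theta M))) ⟩
  thetaTerm 3 (suc M) +ₛ thetaTerm 3 (suc M) +ₛ (0ₛ +ₛ 0ₛ +ₛ (0ₛ +ₛ 0ₛ +ₛ theta 3 M))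
    ≈⟨ ≈-refl ⟩
  theta 3 (suc M)
    ∎
  where
  open SeriesReasoning
  k₁ = suc (3 * M)
  k₂ = suc k₁
  k₃ = suc k₂
  t₁ = thetaTerm 1 k₁
  t₂ = thetaTerm 1 k₂
  t₃ = thetaTerm 1 k₃
  arithmetic₀ : ∀ M → 3 * suc M ≡ suc (suc (suc (3 * M)))
  arithmetic₀ = solve-∀
  arithmetic₁ : ∀ M → 1 * (suc (3 * M) * suc (3 * M)) ≡ suc (3 * (3 * M * M + 2 * M))
  arithmetic₁ = solve-∀
  arithmetic₂ : ∀ M → 1 * (suc (suc (3 * M)) * suc (suc (3 * M))) ≡ suc (3 * (3 * M * M + 4 * M + 1))
  arithmetic₂ = solve-∀
  arithmetic₃ : ∀ M → 1 * (suc (suc (suc (3 * M))) * suc (suc (suc (3 * M)))) ≡ 3 * (3 * (suc M * suc M))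
  arithmetic₃ = solve-∀
  U₃t₁ : U₃ t₁ ≈ 0ₛ
  U₃t₁ = ≈-trans (U₃-cong (≡⇒≈ (cong (monomial (sign k₁)) (arithmetic₁ M))))
                 (U₃-monomial-1+3* (sign k₁) (3 * M * M + 2 * M))
  U₃t₂ : U₃ t₂ ≈ 0ₛ
  U₃t₂ = ≈-trans (U₃-cong (≡⇒≈ (cong (monomial (sign k₂)) (arithmetic₂ M))))
                 (U₃-monomial-1+3* (sign k₂) (3 * M * M + 4 * M + 1))
  U₃t₃ : U₃ t₃ ≈ thetaTerm 3 (suc M)
  U₃t₃ = ≈-trans (U₃-cong (≡⇒≈ (cong (monomial (sign k₃)) (arithmetic₃ M))))
        (≈-trans (U₃-monomial-3* (sign k₃) (3 * (suc M * suc M)))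
                 (≡⇒≈ (cong (λ c → monomial c (3 * (suc M * suc M)))
                            (trans (cong sign (sym (arithmetic₀ M))) (sign-3* (suc M))))))

-- Sums of two squares

Supported : (ℕ → Set) → Series → Set
Supported P s = ∀ i → s i ≢ 𝟎 → P i

IsSquare : ℕ → Set
IsSquare i = ∃[ x ] i ≡ x * x

+ₛ-supported : ∀ {P s t} → Supported P s → Supported P t → Supported P (s +ₛ t)
+ₛ-supported {s = s} {t} s-supp t-supp i s+t≢𝟎 with s i ≟₃ 𝟎
... | yes sᵢ≡𝟎 = t-supp i (λ tᵢ≡𝟎 → s+t≢𝟎 (cong₂ _+₃_ sᵢ≡𝟎 tᵢ≡𝟎))
... | no sᵢ≢𝟎 = s-supp i sᵢ≢𝟎

*ₛ-supported : ∀ {P Q} s t → Supported P s → Supported Q t →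
               ∀ n → (s *ₛ t) n ≢ 𝟎 → ∃[ i ] ∃[ j ] P i × Q j × i + j ≡ n
*ₛ-supported s t s-supp t-supp zero st≢𝟎 =
  0 , 0 , s-supp 0 (λ s₀≡𝟎 → st≢𝟎 (cong (_*₃ t 0) s₀≡𝟎))
        , t-supp 0 (λ t₀≡𝟎 → st≢𝟎 (trans (cong (s 0 *₃_) t₀≡𝟎) (*-zeroʳ (s 0)))) , refl
*ₛ-supported {P} s t s-supp t-supp (suc n) st≢𝟎 with s 0 *₃ t (suc n) ≟₃ 𝟎
... | no s₀t≢𝟎 = 0 , suc n , s-supp 0 (λ s₀≡𝟎 → s₀t≢𝟎 (cong (_*₃ t (suc n)) s₀≡𝟎))
                         , t-supp (suc n) (λ t≡𝟎 → s₀t≢𝟎 (trans (cong (s 0 *₃_) t≡𝟎) (*-zeroʳ (s 0)))) , refl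
... | yes s₀t≡𝟎
  with *ₛ-supported {P ∘ suc} (shift s) t (s-supp ∘ suc) t-supp n (λ rest≡𝟎 → st≢𝟎 (cong₂ _+₃_ s₀t≡𝟎 rest≡𝟎))
...   | i , j , Pi , Qj , i+j≡n = suc i , j , Pi , Qj , cong suc i+j≡n

monomial-supported : ∀ c e → Supported (_≡ e) (monomial c e)
monomial-supported c e i ≢𝟎 with i ℕ.≟ e
... | yes i≡e = i≡e
... | no i≢e = ⊥-elim (≢𝟎 (monomial-≢ c i≢e))

theta-supported : ∀ N → Supported IsSquare (theta 1 N)
theta-supported zero i ≢𝟎 = 0 , monomial-supported 𝟏 0 i ≢𝟎
theta-supported (suc N) = +ₛ-supported (+ₛ-supported term-supported term-supported) (theta-supported N)
  where
  term-supported : Supported IsSquare (thetaTerm 1 (suc N))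
  term-supported i ≢𝟎 = suc N , trans (monomial-supported (sign (suc N)) _ i ≢𝟎) (ℕ.*-identityˡ (suc N * suc N))

[]₃≡𝟎⇒3∣ : ∀ n → [ n ]₃ ≡ 𝟎 → 3 ∣ n
[]₃≡𝟎⇒3∣ zero _ = 3 ∣0
[]₃≡𝟎⇒3∣ (suc (suc (suc n))) [3+n]₃≡𝟎 =
  ∣m∣n⇒∣m+n (n∣n {3}) ([]₃≡𝟎⇒3∣ n (trans (sym (three-𝟏 [ n ]₃)) [3+n]₃≡𝟎))
  where
  three-𝟏 : ∀ a → 𝟏 +₃ (𝟏 +₃ (𝟏 +₃ a)) ≡ a
  three-𝟏 = from-yes (∀₃? λ a → 𝟏 +₃ (𝟏 +₃ (𝟏 +₃ a)) ≟₃ a)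

3∣⇒[]₃≡𝟎 : ∀ {n} → 3 ∣ n → [ n ]₃ ≡ 𝟎
3∣⇒[]₃≡𝟎 (divides q refl) = trans ([]₃-* q 3) (*-zeroʳ [ q ]₃)

squares-𝔽₃ : ∀ a b → a *₃ a +₃ b *₃ b ≡ 𝟎 → a ≡ 𝟎 × b ≡ 𝟎
squares-𝔽₃ = from-yes (∀₃? λ a → ∀₃? λ b → (a *₃ a +₃ b *₃ b ≟₃ 𝟎) →-dec (a ≟₃ 𝟎 ×-dec b ≟₃ 𝟎))

3∣sumOfSquares : ∀ x y → 3 ∣ x * x + y * y → 3 ∣ x × 3 ∣ y
3∣sumOfSquares x y 3∣sum = []₃≡𝟎⇒3∣ x (proj₁ both) , []₃≡𝟎⇒3∣ y (proj₂ both)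
  where
  both = squares-𝔽₃ [ x ]₃ [ y ]₃ (begin
    [ x ]₃ *₃ [ x ]₃ +₃ [ y ]₃ *₃ [ y ]₃  ≡⟨ sym (cong₂ _+₃_ ([]₃-* x x) ([]₃-* y y)) ⟩
    [ x * x ]₃ +₃ [ y * y ]₃              ≡⟨ sym ([]₃-+ (x * x) (y * y)) ⟩
    [ x * x + y * y ]₃                    ≡⟨ 3∣⇒[]₃≡𝟎 3∣sum ⟩
    𝟎                                     ∎)
    where open ≡-Reasoning

sumOfSquares≢3^odd : ∀ α x y u → ¬ 3 ∣ u → x * x + y * y ≢ 3 ^ (1 + 2 * α) * u
sumOfSquares≢3^odd α x y u 3∤u sum≡
  with 3∣sumOfSquares x y (subst (3 ∣_) (sym sum≡) (∣m⇒∣m*n u (m∣m*n (3 ^ (2 * α)))))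
... | divides x′ refl , divides y′ refl = descend α (trans (sym (arithmetic x′ y′)) sum≡)
  where
  s = x′ * x′ + y′ * y′
  arithmetic : ∀ x y → x * 3 * (x * 3) + y * 3 * (y * 3) ≡ 9 * (x * x + y * y)
  arithmetic = solve-∀
  descend : ∀ α → 9 * s ≢ 3 ^ (1 + 2 * α) * u
  descend zero 9s≡3u = 3∤u (divides s (ℕ.*-cancelˡ-≡ u (s * 3) 3 (trans (eq₁ u) (trans (sym 9s≡3u) (eq₂ s)))))
    where
    eq₁ : ∀ u → 3 * u ≡ 3 * 1 * u
    eq₁ = solve-∀
    eq₂ : ∀ s → 9 * s ≡ 3 * (s * 3)
    eq₂ = solve-∀
  descend (suc α) 9s≡ = sumOfSquares≢3^odd α x′ y′ u 3∤u (ℕ.*-cancelˡ-≡ s _ 9 (trans 9s≡ power))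
    where
    exponent : ∀ α → 1 + 2 * suc α ≡ 2 + (1 + 2 * α)
    exponent = solve-∀
    eq : ∀ w u → 3 * (3 * w) * u ≡ 9 * (w * u)
    eq = solve-∀
    power : 3 ^ (1 + 2 * suc α) * u ≡ 9 * (3 ^ (1 + 2 * α) * u)
    power = trans (cong (λ e → 3 ^ e * u) (exponent α)) (eq (3 ^ (1 + 2 * α)) u)

-- The congruences

waysSeries-*ₛ-theta² : ∀ T → waysSeries (partTypes 2 4 T) *ₛ (theta 1 T *ₛ theta 1 T) ≈[ suc T ] 1ₛ
waysSeries-*ₛ-theta² T = begin
  waysSeries (partTypes 2 4 T) *ₛ (theta 1 T *ₛ theta 1 T)
    ≈⟨ *ₛ-cong[] ≈[]-refl (≈[]-sym (eulerProduct-partTypes≈theta² T)) ⟩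
  waysSeries (partTypes 2 4 T) *ₛ eulerProduct (partTypes 2 4 T)
    ≈⟨ ≈⇒≈[] _ (waysSeries-*ₛ-eulerProduct (partTypes 2 4 T) (partTypes-positive 2 4 T)) ⟩
  1ₛ
    ∎
  where open ≈[]-Reasoning (suc T)

theta3-*ₛ-waysSeries : ∀ T → theta 3 T *ₛ waysSeries (partTypes 2 4 T) ≈[ suc T ] theta 1 T
theta3-*ₛ-waysSeries T = begin
  theta 3 T *ₛ A        ≈⟨ ≈⇒≈[] _ (*ₛ-cong (≈-sym (theta-cube T)) ≈-refl) ⟩
  cube φ *ₛ A           ≈⟨ ≈⇒≈[] _ (solve 2 (λ a f → (f :* f :* f) :* a := (a :* (f :* f)) :* f) ≈-refl A φ) ⟩
  A *ₛ (φ *ₛ φ) *ₛ φ    ≈⟨ *ₛ-cong[] (waysSeries-*ₛ-theta² T) ≈[]-refl ⟩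
  1ₛ *ₛ φ               ≈⟨ ≈⇒≈[] _ (*ₛ-identityˡ φ) ⟩
  φ                     ∎
  where
  open ≈[]-Reasoning (suc T)
  A = waysSeries (partTypes 2 4 T)
  φ = theta 1 T

theta-*ₛ-U₃-waysSeries : ∀ m →
  theta 1 (3 * m) *ₛ U₃ (waysSeries (partTypes 2 4 (3 * m))) ≈[ suc m ] cube (theta 1 (3 * m))
theta-*ₛ-U₃-waysSeries m = begin
  theta 1 T *ₛ U₃ A       ≈⟨ ≈⇒≈[] _ (≈-sym (U₃-theta3-*ₛ T A)) ⟩
  U₃ (theta 3 T *ₛ A)     ≈⟨ U₃-≈[] m (theta3-*ₛ-waysSeries T) ⟩
  U₃ (theta 1 T)          ≈⟨ ≈⇒≈[] _ (U₃-theta m) ⟩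
  theta 3 m               ≈⟨ theta-extend 3 (s≤s z≤n) m (m + (m + 0)) ⟩
  theta 3 T               ≈⟨ ≈⇒≈[] _ (≈-sym (theta-cube T)) ⟩
  cube (theta 1 T)        ∎
  where
  open ≈[]-Reasoning (suc m)
  T = 3 * m
  A = waysSeries (partTypes 2 4 T)

U₃-waysSeries≈theta² : ∀ m → U₃ (waysSeries (partTypes 2 4 (3 * m))) ≈[ suc m ] theta 1 (3 * m) *ₛ theta 1 (3 * m)
U₃-waysSeries≈theta² m = begin
  U₃ A
    ≈⟨ ≈⇒≈[] _ (≈-sym (*ₛ-identityʳ (U₃ A))) ⟩
  U₃ A *ₛ 1ₛ
    ≈⟨ *ₛ-cong[] ≈[]-refl (≈[]-sym inverse) ⟩
  U₃ A *ₛ (A *ₛ (φ *ₛ φ))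
    ≈⟨ ≈⇒≈[] _ (solve 3 (λ u a f → u :* (a :* (f :* f)) := (f :* u) :* (a :* f)) ≈-refl (U₃ A) A φ) ⟩
  (φ *ₛ U₃ A) *ₛ (A *ₛ φ)
    ≈⟨ *ₛ-cong[] (theta-*ₛ-U₃-waysSeries m) ≈[]-refl ⟩
  cube φ *ₛ (A *ₛ φ)
    ≈⟨ ≈⇒≈[] _ (solve 2 (λ a f → (f :* f :* f) :* (a :* f) := (f :* f) :* (a :* (f :* f))) ≈-refl A φ) ⟩
  (φ *ₛ φ) *ₛ (A *ₛ (φ *ₛ φ))
    ≈⟨ *ₛ-cong[] ≈[]-refl inverse ⟩
  (φ *ₛ φ) *ₛ 1ₛ
    ≈⟨ ≈⇒≈[] _ (*ₛ-identityʳ (φ *ₛ φ)) ⟩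
  φ *ₛ φ
    ∎
  where
  open ≈[]-Reasoning (suc m)
  A = waysSeries (partTypes 2 4 (3 * m))
  φ = theta 1 (3 * m)
  inverse : A *ₛ (φ *ₛ φ) ≈[ suc m ] 1ₛ
  inverse = ≈[]-weaken (s≤s (ℕ.m≤m+n m (m + (m + 0)))) (waysSeries-*ₛ-theta² (3 * m))

a₂,₄-vanishes : ∀ α v → ¬ 3 ∣ v → 3 ∣ a 2 4 (3 * (3 ^ (1 + 2 * α) * v))
a₂,₄-vanishes α v 3∤v = []₃≡𝟎⇒3∣ _ (trans (U₃-waysSeries≈theta² m m (ℕ.n<1+n m)) φ²ₘ≡𝟎)
  where
  m = 3 ^ (1 + 2 * α) * v
  φ = theta 1 (3 * m)
  φ²ₘ≡𝟎 : (φ *ₛ φ) m ≡ 𝟎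
  φ²ₘ≡𝟎 with (φ *ₛ φ) m ≟₃ 𝟎
  ... | yes ≡𝟎 = ≡𝟎
  ... | no ≢𝟎 with *ₛ-supported φ φ (theta-supported (3 * m)) (theta-supported (3 * m)) m ≢𝟎
  ...   | _ , _ , (x , refl) , (y , refl) , x²+y²≡m = ⊥-elim (sumOfSquares≢3^odd α x y v 3∤v x²+y²≡m)

congruence-index : ∀ α n k → 3 ^ (2 * α + 3) * n + k * 3 ^ (2 * (α + 1)) ≡ 3 * (3 ^ (1 + 2 * α) * (3 * n + k))
congruence-index α n k = begin
  3 ^ (2 * α + 3) * n + k * 3 ^ (2 * (α + 1))
    ≡⟨ cong₂ (λ p q → p * n + k * q) (ℕ.^-distribˡ-+-* 3 (2 * α) 3) (cong (3 ^_) (ℕ.*-distribˡ-+ 2 α 1)) ⟩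
  3 ^ (2 * α) * 27 * n + k * 3 ^ (2 * α + 2)
    ≡⟨ cong (λ q → 3 ^ (2 * α) * 27 * n + k * q) (ℕ.^-distribˡ-+-* 3 (2 * α) 2) ⟩
  3 ^ (2 * α) * 27 * n + k * (3 ^ (2 * α) * 9)
    ≡⟨ arithmetic (3 ^ (2 * α)) n k ⟩
  3 * (3 * 3 ^ (2 * α) * (3 * n + k))
    ∎
  where
  open ≡-Reasoning
  arithmetic : ∀ w n k → w * 27 * n + k * (w * 9) ≡ 3 * (3 * w * (3 * n + k))
  arithmetic = solve-∀

a₂,₄-progression : ∀ α n k → ¬ 3 ∣ k → a 2 4 (3 ^ (2 * α + 3) * n + k * 3 ^ (2 * (α + 1))) % 3 ≡ 0
a₂,₄-progression α n k 3∤k = n∣m⇒m%n≡0 _ 3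
  (subst (λ N → 3 ∣ a 2 4 N) (sym (congruence-index α n k)) (a₂,₄-vanishes α (3 * n + k) 3∤3n+k))
  where
  3∤3n+k : ¬ 3 ∣ 3 * n + k
  3∤3n+k 3∣3n+k = 3∤k (∣m+n∣m⇒∣n 3∣3n+k (m∣m*n n))

corollary4p2 : (α n : ℕ) →
    (a 2 4 (3 ^ (2 * α + 3) * n + 3 ^ (2 * (α + 1))) % 3 ≡ 0)
    × (a 2 4 (3 ^ (2 * α + 3) * n + 2 * 3 ^ (2 * (α + 1))) % 3 ≡ 0)
corollary4p2 α n =
  subst (λ N → a 2 4 (3 ^ (2 * α + 3) * n + N) % 3 ≡ 0) (ℕ.*-identityˡ _) (a₂,₄-progression α n 1 3∤1) ,
  a₂,₄-progression α n 2 3∤2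
  where
  3∤1 : ¬ 3 ∣ 1
  3∤1 = >⇒∤ (s≤s (s≤s z≤n))
  3∤2 : ¬ 3 ∣ 2
  3∤2 = >⇒∤ (s≤s (s≤s (s≤s z≤n)))
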